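{- Let $n\ge 3$. The maximum size (number of edges) of an almost peripheral graph of order $n$ is $\lfloor (n-1)^2/2\rfloor$. If $n$ is odd, this maximum is attained uniquely (up to isomorphism) by the complement of the disjoint union $K_1 + \frac{n-1}{2}K_2$ (i.e. a vertex joined to all vertices of $K_{n-1}$ minus a perfect matching); if $n$ is even, it is attained uniquely by the complement of the disjoint union $K_1+\frac{n-4}{2}K_2+P_3$.
   Context: All graphs are finite and simple. For a connected graph $G$, the eccentricity of a vertex $v$ is $\max_{u\in V(G)} d(v,u)$; the diameter is the maximum eccentricity. A peripheral vertex is one whose eccentricity equals the diameter. A connected graph of order $n$ is almost peripheral if it has exactly $n-1$ peripheral vertices. For graphs $G,H$, $G+H$ denotes their disjoint union, $tK_2$ denotes the disjoint union of $t$ copies of $K_2$, $P_3$ is the path on $3$ vertices, and $\overline{G}$ is the complement of $G$. -}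

module Defs where

open import Data.Nat using (ℕ; zero; suc; _+_; _∸_; _⊔_; _<ᵇ_; _≡ᵇ_; _/_; _%_)
open import Data.Bool using (Bool; true; false; _∧_; _∨_; not; if_then_else_)
open import Data.Fin using (Fin; toℕ)
open import Data.Fin.Properties using (_≟_)
open import Data.Product using (Σ; _×_)
open import Relation.Nullary.Decidable using (⌊_⌋)
open import Relation.Binary.PropositionalEquality using (_≡_)
open import Function.Bundles using (_↔_; Inverse)
open import Relation.Binary.PropositionalEquality using (refl; cong; sym)
open import Relation.Nullary using (yes; no)
open import Data.Empty using (⊥-elim)
open import Data.Bool.Properties using (∨-comm)

record Graph (n : ℕ) : Set where
  field
    adj   : Fin n → Fin n → Bool
    adj-sym    : ∀ u v → adj u v ≡ adj v u
    adj-irrefl : ∀ v → adj v v ≡ false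
open Graph public

_==_ : ∀ {n} → Fin n → Fin n → Bool
u == v = ⌊ u ≟ v ⌋

anyFin : ∀ n → (Fin n → Bool) → Bool
anyFin zero    f = false
anyFin (suc n) f = f Fin.zero ∨ anyFin n (λ i → f (Fin.suc i))

allFin : ∀ n → (Fin n → Bool) → Bool
allFin zero    f = true
allFin (suc n) f = f Fin.zero ∧ allFin n (λ i → f (Fin.suc i))

sumFin : ∀ n → (Fin n → ℕ) → ℕ
sumFin zero    f = 0
sumFin (suc n) f = f Fin.zero + sumFin n (λ i → f (Fin.suc i))

maxFin : ∀ n → (Fin n → ℕ) → ℕ
maxFin zero    f = 0
maxFin (suc n) f = f Fin.zero ⊔ maxFin n (λ i → f (Fin.suc i))

countFin : ∀ n → (Fin n → Bool) → ℕ
countFin n p = sumFin n (λ i → if p i then 1 else 0)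

reach : ∀ {n} → Graph n → ℕ → Fin n → Fin n → Bool
reach         G zero    u v = u == v
reach {n} G (suc k) u v = reach G k u v ∨ anyFin n (λ w → adj G u w ∧ reach G k w v)

-- Connected: every pair of vertices is joined by a walk (length ≤ n suffices)
Connected : ∀ {n} → Graph n → Set
Connected {n} G = ∀ u v → reach G n u v ≡ true

-- least k < bound with p k, or bound if none
firstTrue : ℕ → (ℕ → Bool) → ℕ
firstTrue zero    p = 0
firstTrue (suc b) p = if p 0 then 0 else suc (firstTrue b (λ k → p (suc k)))

-- distance d(u,v): the least k such that a u–v walk of length ≤ k exists
-- (meaningful for connected graphs, where it is < n)
dist : ∀ {n} → Graph n → Fin n → Fin n → ℕ
dist {n} G u v = firstTrue n (λ k → reach G k u v)

ecc : ∀ {n} → Graph n → Fin n → ℕ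
ecc {n} G v = maxFin n (λ u → dist G v u)

diam : ∀ {n} → Graph n → ℕ
diam {n} G = maxFin n (λ v → ecc G v)

Peripheral : ∀ {n} → Graph n → Fin n → Set
Peripheral G v = ecc G v ≡ diam G

numPeripheral : ∀ {n} → Graph n → ℕ
numPeripheral {n} G = countFin n (λ v → ecc G v ≡ᵇ diam G)

AlmostPeripheral : ∀ {n} → Graph n → Set
AlmostPeripheral {n} G = Connected G × numPeripheral G ≡ n ∸ 1

size : ∀ {n} → Graph n → ℕ
size {n} G = sumFin n (λ u → countFin n (λ v → (toℕ u <ᵇ toℕ v) ∧ adj G u v))

_≅_ : ∀ {n} → Graph n → Graph n → Set
_≅_ {n} G H = Σ (Fin n ↔ Fin n) λ f → ∀ u v → adj H (Inverse.to f u) (Inverse.to f v) ≡ adj G u v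

symm : (ℕ → ℕ → Bool) → ℕ → ℕ → Bool
symm e a b = e a b ∨ e b a

complementOf : ∀ {n} (e : ℕ → ℕ → Bool) → Graph n
complementOf e = record
  { adj        = λ u v → not (u == v) ∧ not (symm e (toℕ u) (toℕ v))
  ; adj-sym    = symP
  ; adj-irrefl = irr }
  where
  symP : ∀ u v → not (u == v) ∧ not (symm e (toℕ u) (toℕ v)) ≡ not (v == u) ∧ not (symm e (toℕ v) (toℕ u))
  symP u v with u ≟ v | v ≟ u
  ... | yes p | yes q = refl
  ... | no p  | no q  = cong (λ b → not b) (∨-comm (e (toℕ u) (toℕ v)) (e (toℕ v) (toℕ u)))
  ... | yes p | no q  = ⊥-elim (q (sym p))
  ... | no p  | yes q = ⊥-elim (p (sym q))
  irr : ∀ v → not (v == v) ∧ not (symm e (toℕ v) (toℕ v)) ≡ false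
  irr v with v ≟ v
  ... | yes _ = refl
  ... | no ¬p = ⊥-elim (¬p refl)

-- K₁ + m K₂ on labels 0..2m : vertex 0 isolated, edges {2i+1, 2i+2}.
matchEdge : ℕ → ℕ → Bool
matchEdge zero    b       = false
matchEdge (suc a) zero    = false
matchEdge (suc a) (suc b) = not (a ≡ᵇ b) ∧ (a / 2 ≡ᵇ b / 2)

-- K₁ + P₃ + m K₂ on labels 0..2m+3 : vertex 0 isolated, P₃ = 1–2–3,
-- matching edges {2i+4, 2i+5}.
p3Edge : ℕ → ℕ → Bool
p3Edge a b =
  ((a ≡ᵇ 1) ∧ (b ≡ᵇ 2)) ∨ ((a ≡ᵇ 2) ∧ (b ≡ᵇ 3)) ∨
  ((3 <ᵇ a) ∧ (3 <ᵇ b) ∧ not (a ≡ᵇ b) ∧ (a / 2 ≡ᵇ b / 2))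

oddExtremal : (m : ℕ) → Graph (suc (m + m))
oddExtremal m = complementOf matchEdge

evenExtremal : (m : ℕ) → Graph (suc (suc (suc (suc (m + m)))))
evenExtremal m = complementOf p3Edge

-- Write c(v) for the number of non-neighbours of v. A universal vertex
-- (c(v) = 0) has eccentricity at most 1, so an almost peripheral graph has at
-- most one: two would both be non-peripheral, unless the diameter is 1 and every
-- vertex is peripheral. Hence deg v ≤ n − 2 for all vertices but at most one,
-- and 2|E| ≤ n(n − 2) + 1 = (n − 1)².
--
-- For n odd, equality forces a universal vertex w and c(v) = 1 for every other
-- v. For n even, 2|E| = n(n − 2) leaves slack one. Without a universal vertex
-- all c(v) = 1, every eccentricity is 2 and all vertices are peripheral; so there
-- is a universal w and one vertex x with two non-neighbours y, z, each having x
-- as its only non-neighbour, and c(v) = 1 for all other v.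
--
-- In both cases "the non-neighbour of v" is an involution fixing the listed
-- vertices (w, resp. w y x z) and pairing all others. Two involutions with the
-- same number of fixed points are conjugate by a permutation matching the fixed
-- points as prescribed, and that permutation is the isomorphism onto the
-- complement of K₁ + mK₂, resp. K₁ + P₃ + mK₂.

module Submission where

open import Defs
open import Data.Nat using (ℕ; zero; suc; _+_; _*_; _∸_; _^_; _/_; _≤_; _<_; z≤n; s≤s; _≡ᵇ_; _<ᵇ_)
open import Data.Nat.Properties renaming (_≟_ to _≟ℕ_)
open import Data.Nat.DivMod using (m*n/n≡m; /-monoˡ-≤; m/n≡1+[m∸n]/n)
open import Data.Nat.Tactic.RingSolver using (solve-∀)
open import Data.Bool using (Bool; true; false; _∧_; _∨_; not; if_then_else_)
open import Data.Bool.Properties using (∧-zeroʳ; ∨-zeroʳ; ∨-idem)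
open import Data.Fin as F using (Fin; toℕ; punchIn; punchOut; fromℕ<; _↑ˡ_)
open import Data.Fin.Properties
  using (_≟_; any?; toℕ-injective; toℕ-fromℕ<; toℕ<n; ↑ˡ-injective;
         punchInᵢ≢i; punchIn-punchOut; punchIn-injective; punchOut-injective)
  renaming (suc-injective to Fin-suc-injective)
open import Data.Fin.Permutation
  using (Permutation; _⟨$⟩ʳ_; _⟨$⟩ˡ_; inverseˡ; inverseʳ; flip; insert; insert-punchIn)
  renaming (id to idₚ)
open import Data.Maybe using (Maybe; just; nothing; fromMaybe)
import Data.Maybe as Maybe
open import Data.Product using (Σ; ∃; _×_; _,_; proj₁; proj₂)
open import Data.Sum using (_⊎_; inj₁; inj₂)
open import Data.Empty using (⊥; ⊥-elim)
open import Function.Definitions using (Injective)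
open import Relation.Binary.Definitions using (tri<; tri≈; tri>)
open import Relation.Binary.PropositionalEquality
  using (_≡_; _≢_; refl; sym; trans; cong; cong₂; subst; module ≡-Reasoning)
open import Relation.Nullary using (¬_; Dec; yes; no)

==-refl : ∀ {n} (u : Fin n) → (u == u) ≡ true
==-refl u with u ≟ u
... | yes _ = refl
... | no u≢u = ⊥-elim (u≢u refl)

≢⇒==-false : ∀ {n} {u v : Fin n} → u ≢ v → (u == v) ≡ false
≢⇒==-false {u = u} {v} u≢v with u ≟ v
... | yes u≡v = ⊥-elim (u≢v u≡v)
... | no _ = refl

==⇒≡ : ∀ {n} {u v : Fin n} → (u == v) ≡ true → u ≡ v
==⇒≡ {u = u} {v} _ with u ≟ v
==⇒≡ _  | yes u≡v = u≡v
==⇒≡ () | no _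

==-false⇒≢ : ∀ {n} {u v : Fin n} → (u == v) ≡ false → u ≢ v
==-false⇒≢ {u = u} u≠v refl with trans (sym (==-refl u)) u≠v
... | ()

==-sym : ∀ {n} (u v : Fin n) → (u == v) ≡ (v == u)
==-sym u v with u ≟ v | v ≟ u
... | yes _   | yes _   = refl
... | no _    | no _    = refl
... | yes u≡v | no v≢u  = ⊥-elim (v≢u (sym u≡v))
... | no u≢v  | yes v≡u = ⊥-elim (u≢v (sym v≡u))

==-suc : ∀ {n} (u v : Fin n) → (F.suc u == F.suc v) ≡ (u == v)
==-suc u v with u ≟ v
... | yes refl = refl
... | no _     = refl

==-injective : ∀ {n m} {f : Fin n → Fin m} → Injective _≡_ _≡_ f → ∀ u v → (f u == f v) ≡ (u == v)
==-injective {f = f} f-inj u v with u ≟ v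
... | yes refl = ==-refl (f u)
... | no u≢v   = ≢⇒==-false (λ fu≡fv → u≢v (f-inj fu≡fv))

≡ᵇ-refl : ∀ a → (a ≡ᵇ a) ≡ true
≡ᵇ-refl zero    = refl
≡ᵇ-refl (suc a) = ≡ᵇ-refl a

≡ᵇ-sym : ∀ a b → (a ≡ᵇ b) ≡ (b ≡ᵇ a)
≡ᵇ-sym zero    zero    = refl
≡ᵇ-sym zero    (suc b) = refl
≡ᵇ-sym (suc a) zero    = refl
≡ᵇ-sym (suc a) (suc b) = ≡ᵇ-sym a b

≡ᵇ-true⇒≡ : ∀ a b → (a ≡ᵇ b) ≡ true → a ≡ b
≡ᵇ-true⇒≡ zero    zero    _ = refl
≡ᵇ-true⇒≡ (suc a) (suc b) e = cong suc (≡ᵇ-true⇒≡ a b e)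

≢⇒≡ᵇ-false : ∀ a b → a ≢ b → (a ≡ᵇ b) ≡ false
≢⇒≡ᵇ-false a b a≢b with a ≡ᵇ b in e
... | false = refl
... | true  = ⊥-elim (a≢b (≡ᵇ-true⇒≡ a b e))

==-toℕ : ∀ {n} (u v : Fin n) → (u == v) ≡ (toℕ u ≡ᵇ toℕ v)
==-toℕ u v with u ≟ v
... | yes refl = sym (≡ᵇ-refl (toℕ u))
... | no u≢v   = sym (≢⇒≡ᵇ-false _ _ (λ e → u≢v (toℕ-injective e)))

ind : Bool → ℕ
ind b = if b then 1 else 0

<⇒<ᵇ-true : ∀ {a b} → a < b → (a <ᵇ b) ≡ true
<⇒<ᵇ-true {zero}  {suc b} _       = refl
<⇒<ᵇ-true {suc a} {suc b} (s≤s h) = <⇒<ᵇ-true h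

≤⇒<ᵇ-false : ∀ {a b} → b ≤ a → (a <ᵇ b) ≡ false
≤⇒<ᵇ-false {zero}  z≤n     = refl
≤⇒<ᵇ-false {suc a} z≤n     = refl
≤⇒<ᵇ-false         (s≤s h) = ≤⇒<ᵇ-false h

<ᵇ-split : ∀ a b c → a ≢ b → ind ((a <ᵇ b) ∧ c) + ind ((b <ᵇ a) ∧ c) ≡ ind c
<ᵇ-split a b c a≢b with <-cmp a b
... | tri< a<b _ _ rewrite <⇒<ᵇ-true a<b | ≤⇒<ᵇ-false (<⇒≤ a<b) = +-identityʳ (ind c)
... | tri≈ _ a≡b _ = ⊥-elim (a≢b a≡b)
... | tri> _ _ b<a rewrite <⇒<ᵇ-true b<a | ≤⇒<ᵇ-false (<⇒≤ b<a) = refl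

true⇔true⇒≡ : ∀ {a b} → (a ≡ true → b ≡ true) → (b ≡ true → a ≡ true) → a ≡ b
true⇔true⇒≡ {true}  {true}  _ _ = refl
true⇔true⇒≡ {false} {false} _ _ = refl
true⇔true⇒≡ {true}  {false} a⇒b _ = sym (a⇒b refl)
true⇔true⇒≡ {false} {true}  _ b⇒a = b⇒a refl

¬true⇒false : ∀ {b} {A : Set} → (b ≡ true → A) → (A → ⊥) → b ≡ false
¬true⇒false {false} _ _ = refl
¬true⇒false {true}  f ¬A = ⊥-elim (¬A (f refl))

∨-introˡ : ∀ {a} b → a ≡ true → (a ∨ b) ≡ true
∨-introˡ b refl = refl

∨-introʳ : ∀ a {b} → b ≡ true → (a ∨ b) ≡ true
∨-introʳ true  _ = refl
∨-introʳ false e = e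

∧-intro : ∀ {a b} → a ≡ true → b ≡ true → (a ∧ b) ≡ true
∧-intro refl refl = refl

∧-elimˡ : ∀ a {b} → (a ∧ b) ≡ true → a ≡ true
∧-elimˡ true _ = refl

∧-elimʳ : ∀ a {b} → (a ∧ b) ≡ true → b ≡ true
∧-elimʳ true e = e

not-true : ∀ {b} → not b ≡ true → b ≡ false
not-true {false} _ = refl

sumFin-cong : ∀ n {f g : Fin n → ℕ} → (∀ i → f i ≡ g i) → sumFin n f ≡ sumFin n g
sumFin-cong zero    _ = refl
sumFin-cong (suc n) e = cong₂ _+_ (e F.zero) (sumFin-cong n (λ i → e (F.suc i)))

sumFin-+ : ∀ n (f g : Fin n → ℕ) → sumFin n (λ i → f i + g i) ≡ sumFin n f + sumFin n g
sumFin-+ zero    f g = refl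
sumFin-+ (suc n) f g = trans (cong (f F.zero + g F.zero +_) (sumFin-+ n _ _))
  (+-+-comm (f F.zero) (g F.zero) (sumFin n (λ i → f (F.suc i))) (sumFin n (λ i → g (F.suc i))))
  where
  +-+-comm : ∀ a b c d → a + b + (c + d) ≡ a + c + (b + d)
  +-+-comm a b c d = trans (+-assoc a b (c + d)) (trans (cong (a +_) (trans (sym (+-assoc b c d))
    (trans (cong (_+ d) (+-comm b c)) (+-assoc c b d)))) (sym (+-assoc a c (b + d))))

sumFin-mono-≤ : ∀ n {f g : Fin n → ℕ} → (∀ i → f i ≤ g i) → sumFin n f ≤ sumFin n g
sumFin-mono-≤ zero    _ = z≤n
sumFin-mono-≤ (suc n) h = +-mono-≤ (h F.zero) (sumFin-mono-≤ n (λ i → h (F.suc i)))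

sumFin-const : ∀ n c → sumFin n (λ _ → c) ≡ n * c
sumFin-const zero    c = refl
sumFin-const (suc n) c = cong (c +_) (sumFin-const n c)

sumFin-swap : ∀ n m (f : Fin n → Fin m → ℕ) →
  sumFin n (λ i → sumFin m (f i)) ≡ sumFin m (λ j → sumFin n (λ i → f i j))
sumFin-swap zero    m f = sym (trans (sumFin-const m 0) (*-zeroʳ m))
sumFin-swap (suc n) m f = trans (cong (sumFin m (f F.zero) +_) (sumFin-swap n m (λ i → f (F.suc i))))
  (sym (sumFin-+ m (f F.zero) (λ j → sumFin n (λ i → f (F.suc i) j))))

sumFin-punchIn : ∀ n (f : Fin (suc n) → ℕ) i → sumFin (suc n) f ≡ f i + sumFin n (λ k → f (punchIn i k))
sumFin-punchIn n       f F.zero    = refl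
sumFin-punchIn (suc n) f (F.suc i) rewrite sumFin-punchIn n (λ k → f (F.suc k)) i =
  trans (sym (+-assoc (f F.zero) (f (F.suc i)) rest))
    (trans (cong (_+ rest) (+-comm (f F.zero) (f (F.suc i)))) (+-assoc (f (F.suc i)) (f F.zero) rest))
  where rest = sumFin n (λ k → f (F.suc (punchIn i k)))

sumFin-tight : ∀ n (f g : Fin n → ℕ) → (∀ i → f i ≤ g i) → sumFin n g ≤ sumFin n f → ∀ i → f i ≡ g i
sumFin-tight (suc n) f g f≤g Σg≤Σf F.zero =
  ≤-antisym (f≤g F.zero) (+-cancelʳ-≤ _ _ _ (≤-trans Σg≤Σf (+-monoʳ-≤ (f F.zero) (sumFin-mono-≤ n (λ i → f≤g (F.suc i))))))
sumFin-tight (suc n) f g f≤g Σg≤Σf (F.suc i) =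
  sumFin-tight n (λ k → f (F.suc k)) (λ k → g (F.suc k)) (λ k → f≤g (F.suc k))
    (+-cancelˡ-≤ (f F.zero) _ _ (≤-trans (+-monoˡ-≤ _ (f≤g F.zero)) Σg≤Σf)) i

sumFin-slack-one : ∀ n (f g : Fin n → ℕ) → (∀ i → f i ≤ g i) → sumFin n g ≡ suc (sumFin n f) →
  Σ (Fin n) λ x → suc (f x) ≡ g x × (∀ v → v ≢ x → f v ≡ g v)
sumFin-slack-one (suc n) f g f≤g Σg≡1+Σf with m≤n⇒m<n∨m≡n (f≤g F.zero)
... | inj₁ f0<g0 = F.zero , ≤-antisym f0<g0 g0≤1+f0 , rest
  where
  Σf′ = sumFin n (λ k → f (F.suc k))
  Σg′ = sumFin n (λ k → g (F.suc k))
  g0≤1+f0 : g F.zero ≤ suc (f F.zero)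
  g0≤1+f0 = +-cancelʳ-≤ Σg′ _ _ (≤-trans (≤-reflexive Σg≡1+Σf)
              (+-monoʳ-≤ (suc (f F.zero)) (sumFin-mono-≤ n (λ k → f≤g (F.suc k)))))
  rest : ∀ v → v ≢ F.zero → f v ≡ g v
  rest F.zero    v≢0 = ⊥-elim (v≢0 refl)
  rest (F.suc v) _   = sumFin-tight n _ _ (λ k → f≤g (F.suc k))
    (+-cancelˡ-≤ (suc (f F.zero)) _ _ (≤-trans (+-monoˡ-≤ Σg′ f0<g0) (≤-reflexive Σg≡1+Σf))) v
... | inj₂ f0≡g0 = F.suc x , slack , rest
  where
  r = sumFin-slack-one n (λ k → f (F.suc k)) (λ k → g (F.suc k)) (λ k → f≤g (F.suc k))
        (+-cancelˡ-≡ (g F.zero) _ _ (trans Σg≡1+Σf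
          (trans (sym (+-suc (f F.zero) _)) (cong (_+ suc (sumFin n (λ k → f (F.suc k)))) f0≡g0))))
  x = proj₁ r
  slack = proj₁ (proj₂ r)
  rest : ∀ v → v ≢ F.suc x → f v ≡ g v
  rest F.zero    _   = f0≡g0
  rest (F.suc v) v≢x = proj₂ (proj₂ r) v (λ e → v≢x (cong F.suc e))

countFin-∀ : ∀ n (f : Fin n → Bool) → (∀ i → f i ≡ true) → countFin n f ≡ n
countFin-∀ zero    f _ = refl
countFin-∀ (suc n) f h rewrite h F.zero = cong suc (countFin-∀ n (λ i → f (F.suc i)) (λ i → h (F.suc i)))

countFin-none : ∀ n (f : Fin n → Bool) → (∀ i → f i ≡ false) → countFin n f ≡ 0
countFin-none zero    f _ = refl
countFin-none (suc n) f h rewrite h F.zero = countFin-none n (λ i → f (F.suc i)) (λ i → h (F.suc i))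

countFin≡0⇒false : ∀ n (f : Fin n → Bool) → countFin n f ≡ 0 → ∀ i → f i ≡ false
countFin≡0⇒false (suc n) f e i with f F.zero in f0 | i
... | false | F.zero  = f0
... | false | F.suc i = countFin≡0⇒false n (λ k → f (F.suc k)) e i
countFin≡0⇒false (suc n) f () i | true | _

countFin-witness : ∀ n (f : Fin n → Bool) → 1 ≤ countFin n f → Σ (Fin n) λ i → f i ≡ true
countFin-witness (suc n) f h with f F.zero in f0
... | true  = F.zero , f0
... | false with countFin-witness n (λ k → f (F.suc k)) h
... | i , fi = F.suc i , fi

countFin-punchIn : ∀ n (f : Fin (suc n) → Bool) i → countFin (suc n) f ≡ ind (f i) + countFin n (λ k → f (punchIn i k))
countFin-punchIn n f = sumFin-punchIn n (λ k → ind (f k))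

countFin-punchIn-true : ∀ n (f : Fin (suc n) → Bool) i → f i ≡ true →
  countFin (suc n) f ≡ suc (countFin n (λ k → f (punchIn i k)))
countFin-punchIn-true n f i fi = trans (countFin-punchIn n f i) (cong (λ b → ind b + countFin n (λ k → f (punchIn i k))) fi)

countFin-punchIn-false : ∀ n (f : Fin (suc n) → Bool) i → f i ≡ false →
  countFin (suc n) f ≡ countFin n (λ k → f (punchIn i k))
countFin-punchIn-false n f i fi = trans (countFin-punchIn n f i) (cong (λ b → ind b + countFin n (λ k → f (punchIn i k))) fi)

countFin-mono : ∀ n (f g : Fin n → Bool) → (∀ i → f i ≡ true → g i ≡ true) → countFin n f ≤ countFin n g
countFin-mono n f g f⇒g = sumFin-mono-≤ n ind-mono
  where
  ind-mono : ∀ i → ind (f i) ≤ ind (g i)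
  ind-mono i with f i | g i | f⇒g i
  ... | false | _     | _ = z≤n
  ... | true  | true  | _ = ≤-refl
  ... | true  | false | h with h refl
  ... | ()

countFin-allBut : ∀ n (f : Fin n → Bool) i → f i ≡ false → (∀ k → k ≢ i → f k ≡ true) → countFin n f ≡ n ∸ 1
countFin-allBut (suc n) f i fi h = trans (countFin-punchIn-false n f i fi)
  (countFin-∀ n (λ k → f (punchIn i k)) (λ k → h (punchIn i k) (punchInᵢ≢i i k)))

countFin-== : ∀ n (v : Fin n) → countFin n (_== v) ≡ 1
countFin-== (suc n) v = trans (countFin-punchIn-true n (_== v) v (==-refl v))
  (cong suc (countFin-none n _ (λ k → ≢⇒==-false (punchInᵢ≢i v k))))

countFin-partition : ∀ n (f g h : Fin n → Bool) → (∀ i → ind (f i) + ind (g i) + ind (h i) ≡ 1) →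
  countFin n f + countFin n g + countFin n h ≡ n
countFin-partition n f g h e = trans (cong (_+ countFin n h) (sym (sumFin-+ n _ _)))
  (trans (sym (sumFin-+ n _ _)) (trans (sumFin-cong n e) (trans (sumFin-const n 1) (*-identityʳ n))))

countFin≤1⇒unique : ∀ n (f : Fin n → Bool) → countFin n f ≤ 1 → ∀ i j → f i ≡ true → f j ≡ true → i ≡ j
countFin≤1⇒unique (suc n) f h i j fi fj with i ≟ j
... | yes i≡j = i≡j
... | no i≢j with trans (sym (countFin≡0⇒false n _ rest≡0 (punchOut i≢j))) (trans (cong f (punchIn-punchOut i≢j)) fj)
  where
  rest≡0 : countFin n (λ k → f (punchIn i k)) ≡ 0
  rest≡0 = n≤0⇒n≡0 (≤-pred (subst (_≤ 1) (countFin-punchIn-true n f i fi) h))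
... | ()

unique⇒countFin≤1 : ∀ n (f : Fin n → Bool) → (∀ i j → f i ≡ true → f j ≡ true → i ≡ j) → countFin n f ≤ 1
unique⇒countFin≤1 zero    f _ = z≤n
unique⇒countFin≤1 (suc n) f h with f F.zero in f0
... | false = unique⇒countFin≤1 n (λ k → f (F.suc k)) (λ i j fi fj → Fin-suc-injective (h _ _ fi fj))
... | true  = ≤-reflexive (cong suc (countFin-none n _ rest))
  where
  rest : ∀ k → f (F.suc k) ≡ false
  rest k with f (F.suc k) in fk
  ... | false = refl
  ... | true with h F.zero (F.suc k) f0 fk
  ... | ()

countFin≡1⇒unique : ∀ n (f : Fin n → Bool) → countFin n f ≡ 1 → Σ (Fin n) λ i → f i ≡ true × (∀ k → f k ≡ true → k ≡ i)
countFin≡1⇒unique n f e with countFin-witness n f (≤-reflexive (sym e))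
... | i , fi = i , fi , λ k fk → countFin≤1⇒unique n f (≤-reflexive e) k i fk fi

countFin≡2⇒pair : ∀ n (f : Fin n → Bool) → countFin n f ≡ 2 →
  Σ (Fin n) λ i → Σ (Fin n) λ j → i ≢ j × f i ≡ true × f j ≡ true × (∀ k → f k ≡ true → k ≡ i ⊎ k ≡ j)
countFin≡2⇒pair (suc n) f e with countFin-witness (suc n) f (subst (1 ≤_) (sym e) (s≤s z≤n))
... | i , fi with countFin≡1⇒unique n (λ k → f (punchIn i k)) rest≡1
  where
  rest≡1 : countFin n (λ k → f (punchIn i k)) ≡ 1
  rest≡1 = suc-injective (trans (sym (countFin-punchIn-true n f i fi)) e)
... | j , fj , j-unique = i , punchIn i j , (λ i≡ → punchInᵢ≢i i j (sym i≡)) , fi , fj , only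
  where
  only : ∀ k → f k ≡ true → k ≡ i ⊎ k ≡ punchIn i j
  only k fk with k ≟ i
  ... | yes k≡i = inj₁ k≡i
  ... | no k≢i = inj₂ (trans (sym (punchIn-punchOut i≢k)) (cong (punchIn i)
          (j-unique (punchOut i≢k) (trans (cong f (punchIn-punchOut i≢k)) fk))))
    where i≢k = λ i≡k → k≢i (sym i≡k)

findFin : ∀ {n} → (Fin n → Bool) → Maybe (Fin n)
findFin {zero}  f = nothing
findFin {suc n} f = if f F.zero then just F.zero else Maybe.map F.suc (findFin (λ k → f (F.suc k)))

chooseFin : ∀ {n} → (Fin n → Bool) → Fin n → Fin n
chooseFin f d = fromMaybe d (findFin f)

findFin-just : ∀ {n} (f : Fin n → Bool) i → findFin f ≡ just i → f i ≡ true
findFin-just {suc n} f i e with f F.zero in f0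
findFin-just {suc n} f .F.zero refl | true = f0
... | false with findFin (λ k → f (F.suc k)) in found
findFin-just {suc n} f .(F.suc j) refl | false | just j = findFin-just (λ k → f (F.suc k)) j found

findFin-nothing : ∀ {n} (f : Fin n → Bool) → findFin f ≡ nothing → ∀ i → f i ≡ false
findFin-nothing {suc n} f e i with f F.zero in f0
findFin-nothing {suc n} f () i | true
... | false with findFin (λ k → f (F.suc k)) in found
findFin-nothing {suc n} f refl F.zero    | false | nothing = f0
findFin-nothing {suc n} f refl (F.suc i) | false | nothing = findFin-nothing (λ k → f (F.suc k)) found i

chooseFin-true : ∀ {n} (f : Fin n → Bool) d i → f i ≡ true → f (chooseFin f d) ≡ true
chooseFin-true f d i fi with findFin f in found
... | just j  = findFin-just f j found
... | nothing with trans (sym fi) (findFin-nothing f found i)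
... | ()

chooseFin-default : ∀ {n} (f : Fin n → Bool) d → (∀ i → f i ≡ false) → chooseFin f d ≡ d
chooseFin-default f d none with findFin f in found
... | nothing = refl
... | just j with trans (sym (findFin-just f j found)) (none j)
... | ()

anyFin-intro : ∀ n (f : Fin n → Bool) i → f i ≡ true → anyFin n f ≡ true
anyFin-intro (suc n) f F.zero    fi = ∨-introˡ _ fi
anyFin-intro (suc n) f (F.suc i) fi = ∨-introʳ (f F.zero) (anyFin-intro n (λ k → f (F.suc k)) i fi)

anyFin-elim : ∀ n (f : Fin n → Bool) → anyFin n f ≡ true → Σ (Fin n) λ i → f i ≡ true
anyFin-elim (suc n) f e with f F.zero in f0
... | true  = F.zero , f0
... | false with anyFin-elim n (λ k → f (F.suc k)) e
... | i , fi = F.suc i , fi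

countFin-≢₂ : ∀ n {u v : Fin n} → u ≢ v → countFin n (λ x → not (x == u) ∧ not (x == v)) + 1 + 1 ≡ n
countFin-≢₂ n {u} {v} u≢v = trans (cong₂ (λ a b → countFin n others + a + b) (sym (countFin-== n u)) (sym (countFin-== n v)))
  (countFin-partition n others (_== u) (_== v) partition)
  where
  others : Fin n → Bool
  others x = not (x == u) ∧ not (x == v)
  partition : ∀ x → ind (others x) + ind (x == u) + ind (x == v) ≡ 1
  partition x with x ≟ u | x ≟ v
  ... | yes refl | yes refl = ⊥-elim (u≢v refl)
  ... | yes refl | no _     = refl
  ... | no _     | yes refl = refl
  ... | no _     | no _     = refl

third : ∀ {n} → 3 ≤ n → {u v : Fin n} → u ≢ v → Σ (Fin n) λ t → t ≢ u × t ≢ v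
third {n} 3≤n {u} {v} u≢v with countFin-witness n _ (+-cancelʳ-≤ 2 1 _ (≤-trans 3≤n
                                (≤-reflexive (trans (sym (countFin-≢₂ n u≢v)) (+-assoc _ 1 1)))))
... | t , t≠u,v = t , ==-false⇒≢ (not-true (∧-elimˡ (not (t == u)) t≠u,v)) , ==-false⇒≢ (not-true (∧-elimʳ (not (t == u)) t≠u,v))

+-double-injective : ∀ {s t} → s + s ≡ t + t → s ≡ t
+-double-injective {zero}  {zero}  _ = refl
+-double-injective {suc s} {suc t} e =
  cong suc (+-double-injective (suc-injective (trans (sym (+-suc s s)) (trans (suc-injective e) (+-suc t t)))))

-- Distances, co-degrees and the edge bound

firstTrue-≤ : ∀ b (p : ℕ → Bool) k → p k ≡ true → firstTrue b p ≤ k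
firstTrue-≤ zero    p k       _  = z≤n
firstTrue-≤ (suc b) p k       pk with p 0 in p0
... | true = z≤n
firstTrue-≤ (suc b) p zero    pk | false with trans (sym p0) pk
... | ()
firstTrue-≤ (suc b) p (suc k) pk | false = s≤s (firstTrue-≤ b (λ j → p (suc j)) k pk)

≤-firstTrue : ∀ b (p : ℕ → Bool) k → k ≤ b → (∀ j → j < k → p j ≡ false) → k ≤ firstTrue b p
≤-firstTrue b       p zero    _         _ = z≤n
≤-firstTrue (suc b) p (suc k) (s≤s k≤b) h rewrite h 0 (s≤s z≤n) =
  s≤s (≤-firstTrue b (λ j → p (suc j)) k k≤b (λ j j<k → h (suc j) (s≤s j<k)))

f≤maxFin : ∀ n (f : Fin n → ℕ) i → f i ≤ maxFin n f
f≤maxFin (suc n) f F.zero    = m≤m⊔n _ _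
f≤maxFin (suc n) f (F.suc i) = ≤-trans (f≤maxFin n (λ k → f (F.suc k)) i) (m≤n⊔m _ _)

maxFin-lub : ∀ n (f : Fin n → ℕ) c → (∀ i → f i ≤ c) → maxFin n f ≤ c
maxFin-lub zero    f c _ = z≤n
maxFin-lub (suc n) f c h = ⊔-lub (h F.zero) (maxFin-lub n (λ k → f (F.suc k)) c (λ k → h (F.suc k)))

other : ∀ {n} → 2 ≤ n → Fin n → Fin n
other {suc zero}    (s≤s ()) _
other {suc (suc n)} _ F.zero    = F.suc F.zero
other {suc (suc n)} _ (F.suc _) = F.zero

other-≢ : ∀ {n} (2≤n : 2 ≤ n) v → other 2≤n v ≢ v
other-≢ {suc zero}    (s≤s ()) _
other-≢ {suc (suc n)} _ F.zero    ()
other-≢ {suc (suc n)} _ (F.suc v) ()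

module _ {n : ℕ} (G : Graph n) where

  reach-+ : ∀ k j u v → reach G k u v ≡ true → reach G (j + k) u v ≡ true
  reach-+ k zero    u v r = r
  reach-+ k (suc j) u v r = ∨-introˡ _ (reach-+ k j u v r)

  reach-0 : ∀ u → reach G 0 u u ≡ true
  reach-0 = ==-refl

  reach-1 : ∀ u v → adj G u v ≡ true → reach G 1 u v ≡ true
  reach-1 u v uv = ∨-introʳ (u == v) (anyFin-intro n _ v (∧-intro uv (==-refl v)))

  reach-2 : ∀ u x v → adj G u x ≡ true → adj G x v ≡ true → reach G 2 u v ≡ true
  reach-2 u x v ux xv = ∨-introʳ (reach G 1 u v) (anyFin-intro n _ x (∧-intro ux (reach-1 x v xv)))

  reach-≤2⇒reach-n : 2 ≤ n → ∀ k u v → k ≤ 2 → reach G k u v ≡ true → reach G n u v ≡ true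
  reach-≤2⇒reach-n 2≤n k u v k≤2 r =
    subst (λ j → reach G j u v ≡ true) (m∸n+n≡m (≤-trans k≤2 2≤n)) (reach-+ k (n ∸ k) u v r)

  ¬reach-0 : ∀ u v → u ≢ v → reach G 0 u v ≡ false
  ¬reach-0 u v = ≢⇒==-false

  ¬reach-1 : ∀ u v → u ≢ v → adj G u v ≡ false → reach G 1 u v ≡ false
  ¬reach-1 u v u≢v ¬uv rewrite ≢⇒==-false u≢v with anyFin n (λ w → adj G u w ∧ (w == v)) in walk
  ... | false = refl
  ... | true with anyFin-elim n _ walk
  ... | w , uw∧w≡v with ==⇒≡ (∧-elimʳ (adj G u w) uw∧w≡v)
  ... | refl with trans (sym (∧-elimˡ (adj G u w) uw∧w≡v)) ¬uv
  ... | ()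

  dist-refl : ∀ u → dist G u u ≡ 0
  dist-refl u = n≤0⇒n≡0 (firstTrue-≤ n _ 0 (reach-0 u))

  dist-adj : ∀ u v → adj G u v ≡ true → dist G u v ≤ 1
  dist-adj u v uv = firstTrue-≤ n _ 1 (reach-1 u v uv)

  dist-common : ∀ u x v → adj G u x ≡ true → adj G x v ≡ true → dist G u v ≤ 2
  dist-common u x v ux xv = firstTrue-≤ n _ 2 (reach-2 u x v ux xv)

  dist-≢ : ∀ u v → u ≢ v → 1 ≤ dist G u v
  dist-≢ u v u≢v = ≤-firstTrue n _ 1 (1≤n u) λ { zero _ → ¬reach-0 u v u≢v ; (suc _) (s≤s ()) }
    where
    1≤n : Fin n → 1 ≤ n
    1≤n F.zero    = s≤s z≤n
    1≤n (F.suc _) = s≤s z≤n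

  dist-nonAdj : 2 ≤ n → ∀ u v → u ≢ v → adj G u v ≡ false → 2 ≤ dist G u v
  dist-nonAdj 2≤n u v u≢v ¬uv = ≤-firstTrue n _ 2 2≤n
    λ { zero _ → ¬reach-0 u v u≢v ; (suc zero) _ → ¬reach-1 u v u≢v ¬uv ; (suc (suc _)) (s≤s (s≤s ())) }

  dist≤ecc : ∀ v u → dist G v u ≤ ecc G v
  dist≤ecc v = f≤maxFin n (dist G v)

  ecc≤diam : ∀ v → ecc G v ≤ diam G
  ecc≤diam = f≤maxFin n (ecc G)

  1≤ecc : 2 ≤ n → ∀ v → 1 ≤ ecc G v
  1≤ecc 2≤n v = ≤-trans (dist-≢ v (other 2≤n v) (λ e → other-≢ 2≤n v (sym e))) (dist≤ecc v (other 2≤n v))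

  allPeripheral⇒¬almostPeripheral : 1 ≤ n → (∀ v → ecc G v ≡ diam G) → ¬ AlmostPeripheral G
  allPeripheral⇒¬almostPeripheral (s≤s _) all (_ , #per) =
    1+n≢n (sym (trans (sym #per) (countFin-∀ n _ (λ v → subst (λ d → (d ≡ᵇ diam G) ≡ true) (sym (all v)) (≡ᵇ-refl (diam G))))))

  nonAdj : Fin n → Fin n → Bool
  nonAdj v u = not (u == v) ∧ not (adj G v u)

  degree : Fin n → ℕ
  degree v = countFin n (adj G v)

  coDegree : Fin n → ℕ
  coDegree v = countFin n (nonAdj v)

  isUniversal : Fin n → Bool
  isUniversal v = coDegree v ≡ᵇ 0

  numUniversal : ℕ
  numUniversal = countFin n isUniversal

  degree+coDegree : ∀ v → degree v + coDegree v + 1 ≡ n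
  degree+coDegree v = trans (cong (degree v + coDegree v +_) (sym (countFin-== n v)))
    (countFin-partition n (adj G v) (nonAdj v) (_== v) partition)
    where
    partition : ∀ u → ind (adj G v u) + ind (nonAdj v u) + ind (u == v) ≡ 1
    partition u with u ≟ v
    ... | yes refl rewrite adj-irrefl G u = refl
    ... | no _ with adj G v u
    ... | true  = refl
    ... | false = refl

  nonAdj-sym : ∀ v u → nonAdj v u ≡ nonAdj u v
  nonAdj-sym v u rewrite ==-sym u v | adj-sym G v u = refl

  nonAdj-irrefl : ∀ v → nonAdj v v ≡ false
  nonAdj-irrefl v rewrite ==-refl v = refl

  nonAdj⇒≢ : ∀ v u → nonAdj v u ≡ true → u ≢ v
  nonAdj⇒≢ v u vu refl with trans (sym vu) (nonAdj-irrefl u)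
  ... | ()

  nonAdj⇒¬adj : ∀ v u → nonAdj v u ≡ true → adj G v u ≡ false
  nonAdj⇒¬adj v u vu = not-true (∧-elimʳ (not (u == v)) vu)

  ¬nonAdj⇒adj : ∀ v u → u ≢ v → nonAdj v u ≡ false → adj G v u ≡ true
  ¬nonAdj⇒adj v u u≢v ¬vu rewrite ≢⇒==-false u≢v with adj G v u
  ... | true = refl
  ... | false with ¬vu
  ... | ()

  adj-nonAdj : ∀ u v → u ≢ v → adj G u v ≡ not (nonAdj u v)
  adj-nonAdj u v u≢v rewrite ≢⇒==-false (λ v≡u → u≢v (sym v≡u)) with adj G u v
  ... | true  = refl
  ... | false = refl

  coDegree≡0⇒¬nonAdj : ∀ w → coDegree w ≡ 0 → ∀ v → nonAdj v w ≡ false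
  coDegree≡0⇒¬nonAdj w cw v = trans (nonAdj-sym v w) (countFin≡0⇒false n _ cw v)

  coDegree≡0⇒adj : ∀ w → coDegree w ≡ 0 → ∀ u → u ≢ w → adj G w u ≡ true
  coDegree≡0⇒adj w cw u u≢w = ¬nonAdj⇒adj w u u≢w (countFin≡0⇒false n _ cw u)

  1≤coDegree⇒nonAdj : ∀ v → 1 ≤ coDegree v → Σ (Fin n) λ u → u ≢ v × adj G v u ≡ false
  1≤coDegree⇒nonAdj v h with countFin-witness n (nonAdj v) h
  ... | u , vu = u , nonAdj⇒≢ v u vu , nonAdj⇒¬adj v u vu

  universal⇒ecc≤1 : ∀ w → coDegree w ≡ 0 → ecc G w ≤ 1
  universal⇒ecc≤1 w cw = maxFin-lub n _ 1 dist≤1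
    where
    dist≤1 : ∀ u → dist G w u ≤ 1
    dist≤1 u with u ≟ w
    ... | yes refl rewrite dist-refl u = z≤n
    ... | no u≢w = dist-adj w u (coDegree≡0⇒adj w cw u u≢w)

  -- If diam = 1 every vertex is peripheral, otherwise the two universal
  -- vertices are not; either way there are too few non-peripheral vertices.
  almostPeripheral⇒numUniversal≤1 : AlmostPeripheral G → 2 ≤ n → numUniversal ≤ 1
  almostPeripheral⇒numUniversal≤1 ap@(_ , #per) 2≤n = unique⇒countFin≤1 n isUniversal unique
    where
    unique : ∀ u v → isUniversal u ≡ true → isUniversal v ≡ true → u ≡ v
    unique u v uu uv with u ≟ v | diam G ≟ℕ 1
    ... | yes u≡v | _ = u≡v
    ... | no _ | yes diam≡1 = ⊥-elim (allPeripheral⇒¬almostPeripheral (≤-trans (s≤s z≤n) 2≤n)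
      (λ x → trans (≤-antisym (≤-trans (ecc≤diam x) (≤-reflexive diam≡1)) (1≤ecc 2≤n x)) (sym diam≡1)) ap)
    ... | no u≢v | no diam≢1 = ⊥-elim (<-irrefl refl (begin-strict
        n ∸ 1               ≡⟨ sym #per ⟩
        numPeripheral G     ≤⟨ countFin-mono n _ _ peripheral⇒other ⟩
        countFin n others   ≡⟨ sym (m+n∸n≡m _ 2) ⟩
        countFin n others + 2 ∸ 2 ≡⟨ cong (_∸ 2) (trans (sym (+-assoc _ 1 1)) (countFin-≢₂ n u≢v)) ⟩
        n ∸ 2               <⟨ n∸2<n∸1 2≤n ⟩
        n ∸ 1               ∎))
      where
      open ≤-Reasoning
      n∸2<n∸1 : ∀ {n} → 2 ≤ n → n ∸ 2 < n ∸ 1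
      n∸2<n∸1 (s≤s (s≤s _)) = ≤-refl
      others : Fin n → Bool
      others x = not (x == u) ∧ not (x == v)
      ecc≡1 : ∀ x → isUniversal x ≡ true → ecc G x ≡ 1
      ecc≡1 x ux = ≤-antisym (universal⇒ecc≤1 x (≡ᵇ-true⇒≡ _ 0 ux)) (1≤ecc 2≤n x)
      peripheral⇒other : ∀ x → (ecc G x ≡ᵇ diam G) ≡ true → others x ≡ true
      peripheral⇒other x per with x ≟ u | x ≟ v
      ... | yes refl | _        = ⊥-elim (diam≢1 (trans (sym (≡ᵇ-true⇒≡ _ _ per)) (ecc≡1 x uu)))
      ... | no _     | yes refl = ⊥-elim (diam≢1 (trans (sym (≡ᵇ-true⇒≡ _ _ per)) (ecc≡1 x uv)))
      ... | no _     | no _     = refl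

  handshake : size G + size G ≡ sumFin n degree
  handshake = trans (cong (size G +_) (sym size′)) (trans (sym (sumFin-+ n _ _))
    (sumFin-cong n (λ u → trans (sym (sumFin-+ n (forward u) (backward u))) (sumFin-cong n (split u)))))
    where
    forward backward : Fin n → Fin n → ℕ
    forward  u v = ind ((toℕ u <ᵇ toℕ v) ∧ adj G u v)
    backward u v = ind ((toℕ v <ᵇ toℕ u) ∧ adj G u v)
    size′ : sumFin n (λ u → sumFin n (backward u)) ≡ size G
    size′ = trans (sumFin-swap n n backward)
      (sumFin-cong n (λ v → sumFin-cong n (λ u → cong (λ b → ind ((toℕ v <ᵇ toℕ u) ∧ b)) (adj-sym G u v))))
    split : ∀ u v → forward u v + backward u v ≡ ind (adj G u v)
    split u v with u ≟ v
    ... | yes refl rewrite adj-irrefl G u | ∧-zeroʳ (toℕ u <ᵇ toℕ u) = refl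
    ... | no u≢v = <ᵇ-split (toℕ u) (toℕ v) (adj G u v) (λ e → u≢v (toℕ-injective e))

  sumFin-degree+coDegree : size G + size G + sumFin n coDegree + n ≡ n * n
  sumFin-degree+coDegree = begin
    size G + size G + sumFin n coDegree + n                   ≡⟨ cong (λ d → d + sumFin n coDegree + n) handshake ⟩
    sumFin n degree + sumFin n coDegree + n                   ≡⟨ cong₂ _+_ (sym (sumFin-+ n degree coDegree)) (sym n*1) ⟩
    sumFin n (λ v → degree v + coDegree v) + sumFin n (λ _ → 1) ≡⟨ sym (sumFin-+ n _ _) ⟩
    sumFin n (λ v → degree v + coDegree v + 1)                ≡⟨ sumFin-cong n degree+coDegree ⟩
    sumFin n (λ _ → n)                                        ≡⟨ sumFin-const n n ⟩
    n * n                                                     ∎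
    where
    open ≡-Reasoning
    n*1 : sumFin n (λ _ → 1) ≡ n
    n*1 = trans (sumFin-const n 1) (*-identityʳ n)

  degree≤ : 2 ≤ n → ∀ v → degree v ≤ n ∸ 2 + ind (isUniversal v)
  degree≤ (s≤s (s≤s {n = k} _)) v = bound (degree v) (coDegree v) (degree+coDegree v)
    where
    bound : ∀ d c → d + c + 1 ≡ suc (suc k) → d ≤ k + ind (c ≡ᵇ 0)
    bound d zero    e = ≤-reflexive (+-cancelʳ-≡ 1 d (k + 1) (trans (d+1≡d+0+1 d) (trans e (2+k≡k+1+1 k))))
      where
      d+1≡d+0+1 : ∀ d → d + 1 ≡ d + 0 + 1
      d+1≡d+0+1 = solve-∀
      2+k≡k+1+1 : ∀ k → suc (suc k) ≡ k + 1 + 1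
      2+k≡k+1+1 = solve-∀
    bound d (suc c) e = ≤-trans (m≤m+n d c) (≤-reflexive (+-cancelʳ-≡ 2 (d + c) (k + 0)
      (trans (d+c+2≡d+1+c+1 d c) (trans e (2+k≡k+0+2 k)))))
      where
      d+c+2≡d+1+c+1 : ∀ d c → d + c + 2 ≡ d + suc c + 1
      d+c+2≡d+1+c+1 = solve-∀
      2+k≡k+0+2 : ∀ k → suc (suc k) ≡ k + 0 + 2
      2+k≡k+0+2 = solve-∀

  sumFin-degree≤ : 2 ≤ n → sumFin n degree ≤ n * (n ∸ 2) + numUniversal
  sumFin-degree≤ 2≤n = ≤-trans (sumFin-mono-≤ n (degree≤ 2≤n))
    (≤-reflexive (trans (sumFin-+ n _ _) (cong (_+ numUniversal) (sumFin-const n (n ∸ 2)))))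

  coDegree-from-degree : 2 ≤ n → ∀ v j → degree v + j ≡ n ∸ 2 → coDegree v ≡ suc j
  coDegree-from-degree (s≤s (s≤s {n = k} _)) v j e = +-cancelˡ-≡ (degree v) _ _ (+-cancelʳ-≡ 1 _ _
    (trans (degree+coDegree v) (trans (2+k≡k+2 k) (trans (cong (_+ 2) (sym e)) (d+j+2≡d+1+j+1 (degree v) j)))))
    where
    2+k≡k+2 : ∀ k → suc (suc k) ≡ k + 2
    2+k≡k+2 = solve-∀
    d+j+2≡d+1+j+1 : ∀ d j → d + j + 2 ≡ d + suc j + 1
    d+j+2≡d+1+j+1 = solve-∀

  universal⇒almostPeripheral : 2 ≤ n → ∀ w → coDegree w ≡ 0 → (∀ v → v ≢ w → 1 ≤ coDegree v) → AlmostPeripheral G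
  universal⇒almostPeripheral 2≤n w cw 1≤cv = connected ,
    countFin-allBut n _ w (trans (cong₂ _≡ᵇ_ ecc-w diam≡2) refl)
      (λ v v≢w → trans (cong₂ _≡ᵇ_ (ecc-v v v≢w) diam≡2) refl)
    where
    w~ : ∀ u → u ≢ w → adj G w u ≡ true
    w~ = coDegree≡0⇒adj w cw
    ~w : ∀ u → u ≢ w → adj G u w ≡ true
    ~w u u≢w = trans (adj-sym G u w) (w~ u u≢w)
    connected : Connected G
    connected u v with u ≟ v | u ≟ w | v ≟ w
    ... | yes refl | _ | _ = reach-≤2⇒reach-n 2≤n 0 u u z≤n (reach-0 u)
    ... | no u≢v | yes refl | _ = reach-≤2⇒reach-n 2≤n 1 u v (s≤s z≤n) (reach-1 u v (w~ v (λ v≡w → u≢v (sym v≡w))))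
    ... | no _ | no u≢w | yes refl = reach-≤2⇒reach-n 2≤n 1 u v (s≤s z≤n) (reach-1 u v (~w u u≢w))
    ... | no _ | no u≢w | no v≢w = reach-≤2⇒reach-n 2≤n 2 u v ≤-refl (reach-2 u w v (~w u u≢w) (w~ v v≢w))
    ecc-w : ecc G w ≡ 1
    ecc-w = ≤-antisym (universal⇒ecc≤1 w cw) (1≤ecc 2≤n w)
    ecc-v : ∀ v → v ≢ w → ecc G v ≡ 2
    ecc-v v v≢w with 1≤coDegree⇒nonAdj v (1≤cv v v≢w)
    ... | u , u≢v , ¬vu = ≤-antisym (maxFin-lub n _ 2 dist≤2)
      (≤-trans (dist-nonAdj 2≤n v u (λ v≡u → u≢v (sym v≡u)) ¬vu) (dist≤ecc v u))
      where
      dist≤2 : ∀ x → dist G v x ≤ 2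
      dist≤2 x with x ≟ v | x ≟ w
      ... | yes refl | _ rewrite dist-refl x = z≤n
      ... | no _ | yes refl = ≤-trans (dist-adj v x (~w v v≢w)) (s≤s z≤n)
      ... | no _ | no x≢w = dist-common v w x (~w v v≢w) (w~ x x≢w)
    diam≡2 : diam G ≡ 2
    diam≡2 = ≤-antisym (maxFin-lub n _ 2 ecc≤2)
      (≤-trans (≤-reflexive (sym (ecc-v (other 2≤n w) (other-≢ 2≤n w)))) (ecc≤diam (other 2≤n w)))
      where
      ecc≤2 : ∀ v → ecc G v ≤ 2
      ecc≤2 v with v ≟ w
      ... | yes refl = ≤-trans (≤-reflexive ecc-w) (s≤s z≤n)
      ... | no v≢w = ≤-reflexive (ecc-v v v≢w)

  coDegree≡1⇒adj : ∀ v → coDegree v ≡ 1 → ∀ u → nonAdj v u ≡ true → ∀ t → t ≢ u → t ≢ v → adj G v t ≡ true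
  coDegree≡1⇒adj v c1 u vu t t≢u t≢v with nonAdj v t in vt
  ... | false = ¬nonAdj⇒adj v t t≢v vt
  ... | true  = ⊥-elim (t≢u (countFin≤1⇒unique n (nonAdj v) (≤-reflexive c1) t u vt vu))

  coDegree≡1⇒¬almostPeripheral : 3 ≤ n → (∀ v → coDegree v ≡ 1) → ¬ AlmostPeripheral G
  coDegree≡1⇒¬almostPeripheral 3≤n c1 = allPeripheral⇒¬almostPeripheral (≤-trans (s≤s z≤n) 3≤n) peripheral
    where
    2≤n = ≤-trans (s≤s (s≤s z≤n)) 3≤n
    ecc≡2 : ∀ v → ecc G v ≡ 2
    ecc≡2 v with countFin-witness n (nonAdj v) (≤-reflexive (sym (c1 v)))
    ... | u , vu = ≤-antisym (maxFin-lub n _ 2 dist≤2)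
      (≤-trans (dist-nonAdj 2≤n v u (λ v≡u → nonAdj⇒≢ v u vu (sym v≡u)) (nonAdj⇒¬adj v u vu)) (dist≤ecc v u))
      where
      -- any third vertex is adjacent to both, as u and v are each other's only non-neighbours
      dist≤2 : ∀ x → dist G v x ≤ 2
      dist≤2 x with x ≟ v
      ... | yes refl rewrite dist-refl x = z≤n
      ... | no x≢v = dist≤2′ x x≢v
        where
        dist≤2′ : ∀ x → x ≢ v → dist G v x ≤ 2
        dist≤2′ x x≢v with nonAdj v x in vx
        ... | false = ≤-trans (dist-adj v x (¬nonAdj⇒adj v x x≢v vx)) (s≤s z≤n)
        ... | true with third 3≤n x≢v
        ... | t , t≢x , t≢v = dist-common v t x (coDegree≡1⇒adj v (c1 v) x vx t t≢x t≢v)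
          (trans (adj-sym G t x) (coDegree≡1⇒adj x (c1 x) v (trans (nonAdj-sym x v) vx) t t≢v t≢x))
    peripheral : ∀ v → ecc G v ≡ diam G
    peripheral v = trans (ecc≡2 v) (sym (≤-antisym (maxFin-lub n _ 2 (λ x → ≤-reflexive (ecc≡2 x)))
      (≤-trans (≤-reflexive (sym (ecc≡2 v))) (ecc≤diam v))))

≤⇒≤/2 : ∀ s b → s + s ≤ b → s ≤ b / 2
≤⇒≤/2 s b 2s≤b = ≤-trans (≤-reflexive (sym (m*n/n≡m s 2))) (/-monoˡ-≤ 2 (≤-trans (≤-reflexive (double s)) 2s≤b))
  where
  double : ∀ s → s * 2 ≡ s + s
  double = solve-∀

almostPeripheral⇒size≤ : ∀ n → 2 ≤ n → (G : Graph n) → AlmostPeripheral G → size G ≤ ((n ∸ 1) ^ 2) / 2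
almostPeripheral⇒size≤ n@(suc (suc k)) 2≤n G ap = ≤⇒≤/2 (size G) _ (begin
  size G + size G                   ≡⟨ handshake G ⟩
  sumFin n (degree G)               ≤⟨ sumFin-degree≤ G 2≤n ⟩
  n * k + numUniversal G            ≤⟨ +-monoʳ-≤ (n * k) (almostPeripheral⇒numUniversal≤1 G ap 2≤n) ⟩
  n * k + 1                         ≡⟨ square k ⟩
  (n ∸ 1) ^ 2                       ∎)
  where
  open ≤-Reasoning
  square : ∀ k → suc (suc k) * k + 1 ≡ suc k * (suc k * 1)
  square = solve-∀

-- Conjugacy of involutions

Involution : ∀ {n} → (Fin n → Fin n) → Set
Involution p = ∀ v → p (p v) ≡ v

involution-injective : ∀ {n} {p : Fin n → Fin n} → Involution p → Injective _≡_ _≡_ p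
involution-injective {p = p} inv {u} {v} pu≡pv = trans (sym (inv u)) (trans (cong p pu≡pv) (inv v))

record FixedPoints {n k} (p : Fin n → Fin n) (a : Fin k → Fin n) : Set where
  field
    injective : Injective _≡_ _≡_ a
    fixed     : ∀ i → p (a i) ≡ a i
    only      : ∀ v → p v ≡ v → Σ (Fin k) λ i → v ≡ a i

Conjugating : ∀ {n} → Permutation n n → (Fin n → Fin n) → (Fin n → Fin n) → Set
Conjugating σ p q = ∀ v → p (σ ⟨$⟩ʳ v) ≡ σ ⟨$⟩ʳ q v

insert-self : ∀ {m n} i j (π : Permutation m n) → insert i j π ⟨$⟩ʳ i ≡ j
insert-self i j π with i ≟ i
... | yes _  = refl
... | no i≢i = ⊥-elim (i≢i refl)

module Restriction {n} {p : Fin (suc n) → Fin (suc n)} (inv : Involution p) {c} (pc≡c : p c ≡ c) where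

  c≢p∘punchIn : ∀ j → c ≢ p (punchIn c j)
  c≢p∘punchIn j c≡ = punchInᵢ≢i c j (involution-injective {p = p} inv (trans (sym c≡) (sym pc≡c)))

  restrict : Fin n → Fin n
  restrict j = punchOut (c≢p∘punchIn j)

  punchIn-restrict : ∀ j → punchIn c (restrict j) ≡ p (punchIn c j)
  punchIn-restrict j = punchIn-punchOut (c≢p∘punchIn j)

  restrict-involution : Involution restrict
  restrict-involution j = punchIn-injective c _ _ (begin
    punchIn c (restrict (restrict j)) ≡⟨ punchIn-restrict (restrict j) ⟩
    p (punchIn c (restrict j))        ≡⟨ cong p (punchIn-restrict j) ⟩
    p (p (punchIn c j))               ≡⟨ inv (punchIn c j) ⟩
    punchIn c j                       ∎)
    where open ≡-Reasoning

Conjugate : ∀ {n k} → (Fin n → Fin n) × (Fin k → Fin n) → (Fin n → Fin n) × (Fin k → Fin n) → Set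
Conjugate {n} (p , a) (q , b) = Σ (Permutation n n) λ σ → (∀ i → σ ⟨$⟩ʳ b i ≡ a i) × Conjugating σ p q

-- Fin n is identified with Fin (1 + n) minus the fixed point a₀ via punchIn a₀.
module RemoveFixedPoint {n k} {p : Fin (suc n) → Fin (suc n)} {a : Fin (suc k) → Fin (suc n)}
                        (inv : Involution p) (fp : FixedPoints p a) where
  open FixedPoints fp
  open Restriction {p = p} inv (fixed F.zero) public

  a₀≢a : ∀ i → a F.zero ≢ a (F.suc i)
  a₀≢a i e with injective e
  ... | ()

  points : Fin k → Fin n
  points i = punchOut (a₀≢a i)

  punchIn-points : ∀ i → punchIn (a F.zero) (points i) ≡ a (F.suc i)
  punchIn-points i = punchIn-punchOut (a₀≢a i)

  restrict-fixedPoints : FixedPoints restrict points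
  restrict-fixedPoints = record { injective = inj ; fixed = fix ; only = only′ }
    where
    inj : Injective _≡_ _≡_ points
    inj e = Fin-suc-injective (injective (punchOut-injective (a₀≢a _) (a₀≢a _) e))
    fix : ∀ i → restrict (points i) ≡ points i
    fix i = punchIn-injective (a F.zero) _ _ (begin
      punchIn (a F.zero) (restrict (points i)) ≡⟨ punchIn-restrict (points i) ⟩
      p (punchIn (a F.zero) (points i))        ≡⟨ cong p (punchIn-points i) ⟩
      p (a (F.suc i))                          ≡⟨ fixed (F.suc i) ⟩
      a (F.suc i)                              ≡⟨ sym (punchIn-points i) ⟩
      punchIn (a F.zero) (points i)            ∎)
      where open ≡-Reasoning
    only′ : ∀ v → restrict v ≡ v → Σ (Fin k) λ i → v ≡ points i
    only′ v rv≡v with only (punchIn (a F.zero) v) (trans (sym (punchIn-restrict v)) (cong (punchIn (a F.zero)) rv≡v))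
    ... | F.zero , e = ⊥-elim (punchInᵢ≢i (a F.zero) v e)
    ... | F.suc i , e = i , punchIn-injective (a F.zero) _ _ (trans e (sym (punchIn-points i)))

conjugate-insert : ∀ {n k} {p q : Fin (suc n) → Fin (suc n)} {a b : Fin (suc k) → Fin (suc n)}
  (ip : Involution p) (iq : Involution q) (fa : FixedPoints p a) (fb : FixedPoints q b) →
  Conjugate (RemoveFixedPoint.restrict ip fa , RemoveFixedPoint.points ip fa)
            (RemoveFixedPoint.restrict iq fb , RemoveFixedPoint.points iq fb) →
  Conjugate (p , a) (q , b)
conjugate-insert {p = p} {q} {a} {b} ip iq fa fb (σ′ , σ′b′≡a′ , σ′-conj) = σ , matches , conj
  where
  module P = RemoveFixedPoint ip fa
  module Q = RemoveFixedPoint iq fb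
  open ≡-Reasoning
  σ = insert (b F.zero) (a F.zero) σ′
  σ∘punchIn : ∀ j → σ ⟨$⟩ʳ punchIn (b F.zero) j ≡ punchIn (a F.zero) (σ′ ⟨$⟩ʳ j)
  σ∘punchIn = insert-punchIn (b F.zero) (a F.zero) σ′
  matches : ∀ i → σ ⟨$⟩ʳ b i ≡ a i
  matches F.zero    = insert-self (b F.zero) (a F.zero) σ′
  matches (F.suc i) = begin
    σ ⟨$⟩ʳ b (F.suc i)                          ≡⟨ cong (σ ⟨$⟩ʳ_) (sym (Q.punchIn-points i)) ⟩
    σ ⟨$⟩ʳ punchIn (b F.zero) (Q.points i)      ≡⟨ σ∘punchIn (Q.points i) ⟩
    punchIn (a F.zero) (σ′ ⟨$⟩ʳ Q.points i)     ≡⟨ cong (punchIn (a F.zero)) (σ′b′≡a′ i) ⟩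
    punchIn (a F.zero) (P.points i)             ≡⟨ P.punchIn-points i ⟩
    a (F.suc i)                                 ∎
  conj-punchIn : ∀ j → p (σ ⟨$⟩ʳ punchIn (b F.zero) j) ≡ σ ⟨$⟩ʳ q (punchIn (b F.zero) j)
  conj-punchIn j = begin
    p (σ ⟨$⟩ʳ punchIn (b F.zero) j)              ≡⟨ cong p (σ∘punchIn j) ⟩
    p (punchIn (a F.zero) (σ′ ⟨$⟩ʳ j))           ≡⟨ sym (P.punchIn-restrict (σ′ ⟨$⟩ʳ j)) ⟩
    punchIn (a F.zero) (P.restrict (σ′ ⟨$⟩ʳ j))  ≡⟨ cong (punchIn (a F.zero)) (σ′-conj j) ⟩
    punchIn (a F.zero) (σ′ ⟨$⟩ʳ Q.restrict j)    ≡⟨ sym (σ∘punchIn (Q.restrict j)) ⟩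
    σ ⟨$⟩ʳ punchIn (b F.zero) (Q.restrict j)     ≡⟨ cong (σ ⟨$⟩ʳ_) (Q.punchIn-restrict j) ⟩
    σ ⟨$⟩ʳ q (punchIn (b F.zero) j)              ∎
  conj : Conjugating σ p q
  -- matching on the Dec as an argument, not with `with`, leaves the test b₀ ≟ v
  -- inside insert unabstracted, so that matches and σ∘punchIn still apply
  conj v = by-cases v (b F.zero ≟ v)
    where
    by-cases : ∀ v → Dec (b F.zero ≡ v) → p (σ ⟨$⟩ʳ v) ≡ σ ⟨$⟩ʳ q v
    by-cases _ (yes refl) = begin
      p (σ ⟨$⟩ʳ b F.zero)   ≡⟨ cong p (matches F.zero) ⟩
      p (a F.zero)          ≡⟨ FixedPoints.fixed fa F.zero ⟩
      a F.zero              ≡⟨ sym (matches F.zero) ⟩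
      σ ⟨$⟩ʳ b F.zero       ≡⟨ cong (σ ⟨$⟩ʳ_) (sym (FixedPoints.fixed fb F.zero)) ⟩
      σ ⟨$⟩ʳ q (b F.zero)   ∎
    by-cases v (no b₀≢v) = subst (λ x → p (σ ⟨$⟩ʳ x) ≡ σ ⟨$⟩ʳ q x) (punchIn-punchOut b₀≢v) (conj-punchIn (punchOut b₀≢v))

unpair : ∀ {n} → (Fin n → Fin n) → Fin n → Fin n → Fin n
unpair p u v = if (v == u) ∨ (v == p u) then v else p v

module _ {n} (p : Fin n → Fin n) (u : Fin n) where

  unpair-u : unpair p u u ≡ u
  unpair-u rewrite ==-refl u = refl

  unpair-pu : unpair p u (p u) ≡ p u
  unpair-pu rewrite ==-refl (p u) | ∨-zeroʳ (p u == u) = refl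

  unpair-other : ∀ v → v ≢ u → v ≢ p u → unpair p u v ≡ p v
  unpair-other v v≢u v≢pu rewrite ≢⇒==-false v≢u | ≢⇒==-false v≢pu = refl

module _ {n} {p : Fin n → Fin n} (inv : Involution p) {u : Fin n} (pu≢u : p u ≢ u) where

  unpair-involution : Involution (unpair p u)
  unpair-involution v = by-cases v (v ≟ u) (v ≟ p u)
    where
    by-cases : ∀ v → Dec (v ≡ u) → Dec (v ≡ p u) → unpair p u (unpair p u v) ≡ v
    by-cases _ (yes refl) _        = trans (cong (unpair p u) (unpair-u p u)) (unpair-u p u)
    by-cases _ (no _)     (yes refl) = trans (cong (unpair p u) (unpair-pu p u)) (unpair-pu p u)
    by-cases v (no v≢u)   (no v≢pu)  = begin
      unpair p u (unpair p u v) ≡⟨ cong (unpair p u) (unpair-other p u v v≢u v≢pu) ⟩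
      unpair p u (p v)          ≡⟨ unpair-other p u (p v) (λ pv≡u → v≢pu (trans (sym (inv v)) (cong p pv≡u)))
                                                      (λ pv≡pu → v≢u (involution-injective {p = p} inv pv≡pu)) ⟩
      p (p v)                   ≡⟨ inv v ⟩
      v                         ∎
      where open ≡-Reasoning

  pair : Fin 2 → Fin n
  pair F.zero       = u
  pair (F.suc F.zero) = p u

  unpair-fixedPoints : (∀ v → p v ≢ v) → FixedPoints (unpair p u) pair
  unpair-fixedPoints moved = record { injective = inj ; fixed = fix ; only = only′ }
    where
    inj : Injective _≡_ _≡_ pair
    inj {F.zero}         {F.zero}         _ = refl
    inj {F.zero}         {F.suc F.zero}   e = ⊥-elim (pu≢u (sym e))
    inj {F.suc F.zero}   {F.zero}         e = ⊥-elim (pu≢u e)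
    inj {F.suc F.zero}   {F.suc F.zero}   _ = refl
    fix : ∀ i → unpair p u (pair i) ≡ pair i
    fix F.zero         = unpair-u p u
    fix (F.suc F.zero) = unpair-pu p u
    only′ : ∀ v → unpair p u v ≡ v → Σ (Fin 2) λ i → v ≡ pair i
    only′ v fixed = by-cases (v ≟ u) (v ≟ p u)
      where
      by-cases : Dec (v ≡ u) → Dec (v ≡ p u) → Σ (Fin 2) λ i → v ≡ pair i
      by-cases (yes v≡u) _         = F.zero , v≡u
      by-cases (no _)    (yes v≡pu) = F.suc F.zero , v≡pu
      by-cases (no v≢u)  (no v≢pu) = ⊥-elim (moved v (trans (sym (unpair-other p u v v≢u v≢pu)) fixed))

⟨$⟩ʳ-injective : ∀ {n} (σ : Permutation n n) → Injective _≡_ _≡_ (σ ⟨$⟩ʳ_)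
⟨$⟩ʳ-injective σ e = trans (sym (inverseˡ σ)) (trans (cong (σ ⟨$⟩ˡ_) e) (inverseˡ σ))

unpair-conjugating : ∀ {n} {p q : Fin n → Fin n} (ip : Involution p) (iq : Involution q) {u u′} (σ : Permutation n n) →
  σ ⟨$⟩ʳ u′ ≡ u → σ ⟨$⟩ʳ q u′ ≡ p u → Conjugating σ (unpair p u) (unpair q u′) → Conjugating σ p q
unpair-conjugating {p = p} {q} ip iq {u} {u′} σ σu′≡u σqu′≡pu conj v with v ≟ u′ | v ≟ q u′
... | yes refl | _        = trans (cong p σu′≡u) (sym σqu′≡pu)
... | no _     | yes refl = trans (cong p σqu′≡pu) (trans (ip u) (trans (sym σu′≡u) (cong (σ ⟨$⟩ʳ_) (sym (iq u′)))))
... | no v≢u′  | no v≢qu′ = begin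
  p (σ ⟨$⟩ʳ v)               ≡⟨ sym (unpair-other p u (σ ⟨$⟩ʳ v) (λ e → v≢u′ (σ-injective (trans e (sym σu′≡u))))
                                                               (λ e → v≢qu′ (σ-injective (trans e (sym σqu′≡pu))))) ⟩
  unpair p u (σ ⟨$⟩ʳ v)      ≡⟨ conj v ⟩
  σ ⟨$⟩ʳ unpair q u′ v       ≡⟨ cong (σ ⟨$⟩ʳ_) (unpair-other q u′ v v≢u′ v≢qu′) ⟩
  σ ⟨$⟩ʳ q v                 ∎
  where
  open ≡-Reasoning
  σ-injective = ⟨$⟩ʳ-injective σ

-- Removing fixed points one at a time reduces to fixed-point-free involutions;
-- those are split by unpairing the 2-cycle of 0 and removing its two points.
involutions-conjugate : ∀ n {k} {p q : Fin n → Fin n} {a b : Fin k → Fin n} →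
  Involution p → Involution q → FixedPoints p a → FixedPoints q b → Conjugate (p , a) (q , b)
involutions-conjugate zero          {zero}          _  _  _  _  = idₚ , (λ ()) , (λ ())
involutions-conjugate zero          {suc k} {a = a} _  _  _  _  with a F.zero
... | ()
involutions-conjugate (suc n)       {suc k}         ip iq fa fb =
  conjugate-insert ip iq fa fb (involutions-conjugate n P.restrict-involution Q.restrict-involution P.restrict-fixedPoints Q.restrict-fixedPoints)
  where
  module P = RemoveFixedPoint ip fa
  module Q = RemoveFixedPoint iq fb
involutions-conjugate (suc zero)    {zero}  {p}     _  _  fa _  with FixedPoints.only fa F.zero (one (p F.zero))
  where
  one : ∀ (x : Fin 1) → x ≡ F.zero
  one F.zero = refl
... | () , _
involutions-conjugate (suc (suc n)) {zero}  {p} {q} ip iq fa fb =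
  σ , (λ ()) , unpair-conjugating {p = p} {q} ip iq {F.zero} {F.zero} σ (σ-matches F.zero) (σ-matches (F.suc F.zero)) σ-conj
  where
  moved : ∀ {r : Fin (suc (suc n)) → Fin (suc (suc n))} {c : Fin 0 → Fin (suc (suc n))} →
          FixedPoints r c → ∀ v → r v ≢ v
  moved fc v rv≡v with FixedPoints.only fc v rv≡v
  ... | () , _
  ip′ : Involution (unpair p F.zero)
  ip′ = unpair-involution ip (moved fa F.zero)
  iq′ : Involution (unpair q F.zero)
  iq′ = unpair-involution iq (moved fb F.zero)
  fa′ : FixedPoints (unpair p F.zero) (pair ip (moved fa F.zero))
  fa′ = unpair-fixedPoints ip (moved fa F.zero) (moved fa)
  fb′ : FixedPoints (unpair q F.zero) (pair iq (moved fb F.zero))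
  fb′ = unpair-fixedPoints iq (moved fb F.zero) (moved fb)
  c : Conjugate (unpair p F.zero , pair ip (moved fa F.zero)) (unpair q F.zero , pair iq (moved fb F.zero))
  c = conjugate-insert ip′ iq′ fa′ fb′ (conjugate-insert P₁.restrict-involution Q₁.restrict-involution P₁.restrict-fixedPoints Q₁.restrict-fixedPoints
        (involutions-conjugate n P₂.restrict-involution Q₂.restrict-involution P₂.restrict-fixedPoints Q₂.restrict-fixedPoints))
    where
    module P₁ = RemoveFixedPoint ip′ fa′
    module Q₁ = RemoveFixedPoint iq′ fb′
    module P₂ = RemoveFixedPoint P₁.restrict-involution P₁.restrict-fixedPoints
    module Q₂ = RemoveFixedPoint Q₁.restrict-involution Q₁.restrict-fixedPoints
  σ : Permutation (suc (suc n)) (suc (suc n))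
  σ = proj₁ c
  σ-matches : ∀ i → σ ⟨$⟩ʳ pair iq (moved fb F.zero) i ≡ pair ip (moved fa F.zero) i
  σ-matches = proj₁ (proj₂ c)
  σ-conj : Conjugating σ (unpair p F.zero) (unpair q F.zero)
  σ-conj = proj₂ (proj₂ c)

-- Graphs whose complement is a matching off a list of vertices

_∉_ : ∀ {n k} → Fin n → (Fin k → Fin n) → Set
v ∉ a = ∀ i → v ≢ a i

record MatchingOutside {n k} (G : Graph n) (a : Fin k → Fin n) : Set where
  field
    injective      : Injective _≡_ _≡_ a
    coDegree-one   : ∀ v → v ∉ a → coDegree G v ≡ 1
    nonAdj-outside : ∀ v u → v ∉ a → nonAdj G v u ≡ true → u ∉ a

module Partner {n k} {G : Graph n} {a : Fin k → Fin n} (m : MatchingOutside G a) where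
  open MatchingOutside m

  member? : ∀ v → Dec (∃ λ i → v ≡ a i)
  member? v = any? (λ i → v ≟ a i)

  inside : Fin n → Bool
  inside u = anyFin k (λ i → u == a i)

  ∉⇒¬inside : ∀ u → u ∉ a → inside u ≡ false
  ∉⇒¬inside u u∉a with inside u in e
  ... | false = refl
  ... | true with anyFin-elim k _ e
  ... | i , u≡ai = ⊥-elim (u∉a i (==⇒≡ u≡ai))

  inside-a : ∀ i → inside (a i) ≡ true
  inside-a i = anyFin-intro k _ i (==-refl (a i))

  partner : Fin n → Fin n
  partner v = chooseFin (λ u → nonAdj G v u ∧ not (inside u)) v

  module _ (v : Fin n) (v∉a : v ∉ a) where

    nonAdj-partner : nonAdj G v (partner v) ≡ true
    nonAdj-partner with countFin-witness n (nonAdj G v) (≤-reflexive (sym (coDegree-one v v∉a)))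
    ... | u , vu = ∧-elimˡ (nonAdj G v (partner v))
      (chooseFin-true (λ u → nonAdj G v u ∧ not (inside u)) v u (∧-intro vu (cong not (∉⇒¬inside u (nonAdj-outside v u v∉a vu)))))

    partner-unique : ∀ u → nonAdj G v u ≡ true → u ≡ partner v
    partner-unique u vu = countFin≤1⇒unique n (nonAdj G v) (≤-reflexive (coDegree-one v v∉a)) u (partner v) vu nonAdj-partner

    partner-∉ : partner v ∉ a
    partner-∉ = nonAdj-outside v (partner v) v∉a nonAdj-partner

    partner-≢ : partner v ≢ v
    partner-≢ = nonAdj⇒≢ G v (partner v) nonAdj-partner

  nonAdj-a-∉ : ∀ i u → u ∉ a → nonAdj G (a i) u ≡ false
  nonAdj-a-∉ i u u∉a with nonAdj G (a i) u in e
  ... | false = refl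
  ... | true = ⊥-elim (nonAdj-outside u (a i) u∉a (trans (nonAdj-sym G u (a i)) e) i refl)

  ¬member⇒∉ : ∀ {v} → ¬ (∃ λ i → v ≡ a i) → v ∉ a
  ¬member⇒∉ ¬member i v≡ai = ¬member (i , v≡ai)

  partner-fixed : ∀ i → partner (a i) ≡ a i
  partner-fixed i = chooseFin-default (λ u → nonAdj G (a i) u ∧ not (inside u)) (a i) never
    where
    never : ∀ u → (nonAdj G (a i) u ∧ not (inside u)) ≡ false
    never u with member? u
    ... | yes (j , refl) rewrite inside-a j = ∧-zeroʳ _
    ... | no u∉a rewrite nonAdj-a-∉ i u (¬member⇒∉ u∉a) = refl

  partner-involution : Involution partner
  partner-involution v with member? v
  ... | yes (i , refl) = trans (cong partner (partner-fixed i)) (partner-fixed i)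
  ... | no v∉a = sym (partner-unique (partner v) (partner-∉ v (¬member⇒∉ v∉a)) v
                  (trans (nonAdj-sym G (partner v) v) (nonAdj-partner v (¬member⇒∉ v∉a))))

  partner-fixedPoints : FixedPoints partner a
  partner-fixedPoints = record { injective = injective ; fixed = partner-fixed ; only = only }
    where
    only : ∀ v → partner v ≡ v → ∃ λ i → v ≡ a i
    only v pv≡v with member? v
    ... | yes member = member
    ... | no v∉a     = ⊥-elim (partner-≢ v (¬member⇒∉ v∉a) pv≡v)

  nonAdj-∉ : ∀ v → v ∉ a → ∀ u → nonAdj G v u ≡ (u == partner v)
  nonAdj-∉ v v∉a u = true⇔true⇒≡ (λ vu → subst (λ x → (u == x) ≡ true) (partner-unique v v∉a u vu) (==-refl u))
                                  (λ u≡ → subst (λ x → nonAdj G v x ≡ true) (sym (==⇒≡ u≡)) (nonAdj-partner v v∉a))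

-- The partner involutions are conjugate by a permutation σ taking b to a, and
-- σ then carries the complement of H onto that of G: off the lists both are the
-- matchings given by the partners, and on the lists they agree by hypothesis.
≅-fromMatchingOutside : ∀ {n k} {G H : Graph n} {a b : Fin k → Fin n} → MatchingOutside G a → MatchingOutside H b →
  (∀ i j → nonAdj G (a i) (a j) ≡ nonAdj H (b i) (b j)) → G ≅ H
≅-fromMatchingOutside {n} {G = G} {H} {a} {b} mG mH same-on-a = flip σ , adj-σ⁻¹
  where
  module PG = Partner mG
  module PH = Partner mH
  conjugation = involutions-conjugate n PG.partner-involution PH.partner-involution PG.partner-fixedPoints PH.partner-fixedPoints
  σ : Permutation n n
  σ = proj₁ conjugation
  s : Fin n → Fin n
  s = σ ⟨$⟩ʳ_
  σb≡a : ∀ i → s (b i) ≡ a i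
  σb≡a = proj₁ (proj₂ conjugation)
  σ-∉ : ∀ i → i ∉ b → s i ∉ a
  σ-∉ i i∉b k σi≡ak = i∉b k (⟨$⟩ʳ-injective σ (trans σi≡ak (sym (σb≡a k))))
  nonAdj-σ : ∀ i j → nonAdj G (s i) (s j) ≡ nonAdj H i j
  nonAdj-σ i j with PH.member? i | PH.member? j
  ... | yes (k , refl) | yes (l , refl) rewrite σb≡a k | σb≡a l = same-on-a k l
  ... | yes (k , refl) | no j∉b rewrite σb≡a k =
    trans (PG.nonAdj-a-∉ k (s j) (σ-∉ j (PH.¬member⇒∉ j∉b))) (sym (PH.nonAdj-a-∉ k j (PH.¬member⇒∉ j∉b)))
  ... | no i∉b | _ = begin
    nonAdj G (s i) (s j)             ≡⟨ PG.nonAdj-∉ (s i) (σ-∉ i (PH.¬member⇒∉ i∉b)) (s j) ⟩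
    (s j == PG.partner (s i))        ≡⟨ cong (s j ==_) (proj₂ (proj₂ conjugation) i) ⟩
    (s j == s (PH.partner i))        ≡⟨ ==-injective (⟨$⟩ʳ-injective σ) j (PH.partner i) ⟩
    (j == PH.partner i)              ≡⟨ sym (PH.nonAdj-∉ i (PH.¬member⇒∉ i∉b) j) ⟩
    nonAdj H i j                     ∎
    where open ≡-Reasoning
  adj-σ : ∀ i j → adj G (s i) (s j) ≡ adj H i j
  adj-σ i j with i ≟ j
  ... | yes refl = trans (adj-irrefl G (s i)) (sym (adj-irrefl H i))
  ... | no i≢j = trans (adj-nonAdj G (s i) (s j) (λ e → i≢j (⟨$⟩ʳ-injective σ e)))
                   (trans (cong not (nonAdj-σ i j)) (sym (adj-nonAdj H i j i≢j)))
  adj-σ⁻¹ : ∀ u v → adj H (σ ⟨$⟩ˡ u) (σ ⟨$⟩ˡ v) ≡ adj G u v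
  adj-σ⁻¹ u v = trans (sym (adj-σ (σ ⟨$⟩ˡ u) (σ ⟨$⟩ˡ v))) (cong₂ (adj G) (inverseʳ σ) (inverseʳ σ))

-- The extremal graphs

partnerℕ : ℕ → ℕ
partnerℕ zero          = 1
partnerℕ (suc zero)    = 0
partnerℕ (suc (suc a)) = suc (suc (partnerℕ a))

partnerℕ-≢ : ∀ a → partnerℕ a ≢ a
partnerℕ-≢ (suc (suc a)) e = partnerℕ-≢ a (suc-injective (suc-injective e))

partnerℕ-< : ∀ m a → a < m + m → partnerℕ a < m + m
partnerℕ-< (suc m) zero          _ = s≤s (subst (1 ≤_) (sym (+-suc m m)) (s≤s z≤n))
partnerℕ-< (suc m) (suc zero)    _ = s≤s z≤n
partnerℕ-< (suc m) (suc (suc a)) a<2m+2 rewrite +-suc m m =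
  s≤s (s≤s (partnerℕ-< m a (≤-pred (≤-pred a<2m+2))))

/2-suc-suc : ∀ a → suc (suc a) / 2 ≡ suc (a / 2)
/2-suc-suc a = m/n≡1+[m∸n]/n {suc (suc a)} {2} (s≤s (s≤s z≤n))

/2≡/2⇔partnerℕ : ∀ a b → a ≢ b → (a / 2 ≡ᵇ b / 2) ≡ (b ≡ᵇ partnerℕ a)
/2≡/2⇔partnerℕ zero          zero          a≢b = ⊥-elim (a≢b refl)
/2≡/2⇔partnerℕ zero          (suc zero)    _   = refl
/2≡/2⇔partnerℕ zero          (suc (suc b)) _   rewrite /2-suc-suc b = refl
/2≡/2⇔partnerℕ (suc zero)    zero          _   = refl
/2≡/2⇔partnerℕ (suc zero)    (suc zero)    a≢b = ⊥-elim (a≢b refl)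
/2≡/2⇔partnerℕ (suc zero)    (suc (suc b)) _   rewrite /2-suc-suc b = refl
/2≡/2⇔partnerℕ (suc (suc a)) zero          _   rewrite /2-suc-suc a = refl
/2≡/2⇔partnerℕ (suc (suc a)) (suc zero)    _   rewrite /2-suc-suc a = refl
/2≡/2⇔partnerℕ (suc (suc a)) (suc (suc b)) a≢b rewrite /2-suc-suc a | /2-suc-suc b =
  /2≡/2⇔partnerℕ a b (λ e → a≢b (cong (λ k → suc (suc k)) e))

-- the edges of the matching {2i, 2i+1}, as they occur in matchEdge and p3Edge
blockEdge : ℕ → ℕ → Bool
blockEdge a b = not (a ≡ᵇ b) ∧ (a / 2 ≡ᵇ b / 2)

blockEdge-symm : ∀ a b → (blockEdge a b ∨ blockEdge b a) ≡ (b ≡ᵇ partnerℕ a)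
blockEdge-symm a b with a ≟ℕ b
... | yes refl rewrite ≡ᵇ-refl a = sym (≢⇒≡ᵇ-false a (partnerℕ a) (λ e → partnerℕ-≢ a (sym e)))
... | no a≢b rewrite ≢⇒≡ᵇ-false a b a≢b | ≢⇒≡ᵇ-false b a (λ e → a≢b (sym e)) | ≡ᵇ-sym (b / 2) (a / 2) =
  trans (∨-idem (a / 2 ≡ᵇ b / 2)) (/2≡/2⇔partnerℕ a b a≢b)

pairPartner : ∀ m → Fin (m + m) → Fin (m + m)
pairPartner m j = fromℕ< (partnerℕ-< m (toℕ j) (toℕ<n j))

toℕ-pairPartner : ∀ m j → toℕ (pairPartner m j) ≡ partnerℕ (toℕ j)
toℕ-pairPartner m j = toℕ-fromℕ< (partnerℕ-< m (toℕ j) (toℕ<n j))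

pairPartner-≢ : ∀ m j → pairPartner m j ≢ j
pairPartner-≢ m j e = partnerℕ-≢ (toℕ j) (trans (sym (toℕ-pairPartner m j)) (cong toℕ e))

blockEdge-pairPartner : ∀ m (j k : Fin (m + m)) →
  not (k == j) ∧ (blockEdge (toℕ j) (toℕ k) ∨ blockEdge (toℕ k) (toℕ j)) ≡ (k == pairPartner m j)
blockEdge-pairPartner m j k = trans (cong (not (k == j) ∧_) (trans (blockEdge-symm (toℕ j) (toℕ k))
  (sym (trans (==-toℕ k (pairPartner m j)) (cong (toℕ k ≡ᵇ_) (toℕ-pairPartner m j)))))) absorb
  where
  absorb : not (k == j) ∧ (k == pairPartner m j) ≡ (k == pairPartner m j)
  absorb with k ≟ pairPartner m j
  ... | yes refl rewrite ≢⇒==-false (pairPartner-≢ m j) = refl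
  ... | no _ = ∧-zeroʳ _

nonAdj-complementOf : ∀ {n} e (v u : Fin n) → nonAdj (complementOf e) v u ≡ not (u == v) ∧ symm e (toℕ v) (toℕ u)
nonAdj-complementOf e v u with u ≟ v
... | yes refl = refl
... | no u≢v rewrite ≢⇒==-false (λ v≡u → u≢v (sym v≡u)) with symm e (toℕ v) (toℕ u)
... | true  = refl
... | false = refl

size-from-coDegree : ∀ {n} (G : Graph n) t → t + t + sumFin n (coDegree G) + n ≡ n * n → size G ≡ t
size-from-coDegree {n} G t e = +-double-injective (+-cancelʳ-≡ (sumFin n (coDegree G) + n) _ _
  (trans (sym (+-assoc (size G + size G) _ n)) (trans (sumFin-degree+coDegree G) (trans (sym e) (+-assoc (t + t) _ n)))))

half-square-even : ∀ m → ((m + m) ^ 2) / 2 ≡ m * m + m * m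
half-square-even m = trans (cong (_/ 2) (square m)) (m*n/n≡m (m * m + m * m) 2)
  where
  square : ∀ m → (m + m) * ((m + m) * 1) ≡ (m * m + m * m) * 2
  square = solve-∀

half-square-odd : ∀ m → ((3 + (m + m)) ^ 2) / 2 ≡ suc m * (m + m + 4)
half-square-odd m = trans (cong (_/ 2) (square m)) (half-suc-double (suc m * (m + m + 4)))
  where
  square : ∀ m → (3 + (m + m)) * ((3 + (m + m)) * 1) ≡ suc ((suc m * (m + m + 4)) * 2)
  square = solve-∀
  half-suc-double : ∀ a → suc (a * 2) / 2 ≡ a
  half-suc-double zero    = refl
  half-suc-double (suc a) = trans (/2-suc-suc (suc (a * 2))) (cong suc (half-suc-double a))

module OddExtremal (m : ℕ) where

  nonAdj-zero : ∀ u → nonAdj (oddExtremal m) F.zero u ≡ false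
  nonAdj-zero F.zero    = refl
  nonAdj-zero (F.suc _) = refl

  nonAdj-suc : ∀ j u → nonAdj (oddExtremal m) (F.suc j) u ≡ (u == F.suc (pairPartner m j))
  nonAdj-suc j F.zero    = refl
  nonAdj-suc j (F.suc k) = begin
    nonAdj (oddExtremal m) (F.suc j) (F.suc k)                                ≡⟨ nonAdj-complementOf matchEdge (F.suc j) (F.suc k) ⟩
    not (F.suc k == F.suc j) ∧ (blockEdge (toℕ j) (toℕ k) ∨ blockEdge (toℕ k) (toℕ j)) ≡⟨ cong (λ b → not b ∧ (blockEdge (toℕ j) (toℕ k) ∨ blockEdge (toℕ k) (toℕ j))) (==-suc k j) ⟩
    not (k == j) ∧ (blockEdge (toℕ j) (toℕ k) ∨ blockEdge (toℕ k) (toℕ j))   ≡⟨ blockEdge-pairPartner m j k ⟩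
    (k == pairPartner m j)                                                    ≡⟨ sym (==-suc k (pairPartner m j)) ⟩
    (F.suc k == F.suc (pairPartner m j))                                      ∎
    where open ≡-Reasoning

  coDegree-zero : coDegree (oddExtremal m) F.zero ≡ 0
  coDegree-zero = countFin-none (suc (m + m)) _ nonAdj-zero

  coDegree-suc : ∀ j → coDegree (oddExtremal m) (F.suc j) ≡ 1
  coDegree-suc j = trans (sumFin-cong (suc (m + m)) (λ u → cong ind (nonAdj-suc j u))) (countFin-== (suc (m + m)) (F.suc (pairPartner m j)))

  matchingOutside : MatchingOutside (oddExtremal m) (λ (_ : Fin 1) → F.zero)
  matchingOutside = record { injective = λ { {F.zero} {F.zero} _ → refl } ; coDegree-one = one ; nonAdj-outside = outside }
    where
    one : ∀ v → v ∉ (λ (_ : Fin 1) → F.zero) → coDegree (oddExtremal m) v ≡ 1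
    one F.zero    v∉ = ⊥-elim (v∉ F.zero refl)
    one (F.suc j) _  = coDegree-suc j
    outside : ∀ v u → v ∉ (λ (_ : Fin 1) → F.zero) → nonAdj (oddExtremal m) v u ≡ true → u ∉ (λ (_ : Fin 1) → F.zero)
    outside F.zero    u v∉ _  = ⊥-elim (v∉ F.zero refl)
    outside (F.suc j) u _  vu F.zero u≡0 with trans (sym (nonAdj-suc j u)) vu
    ... | u≡ rewrite u≡0 with u≡
    ... | ()

  almostPeripheral : 1 ≤ m → AlmostPeripheral (oddExtremal m)
  almostPeripheral 1≤m = universal⇒almostPeripheral (oddExtremal m) (s≤s (≤-trans 1≤m (m≤m+n m m))) F.zero coDegree-zero
    λ { F.zero 0≢0 → ⊥-elim (0≢0 refl) ; (F.suc j) _ → ≤-reflexive (sym (coDegree-suc j)) }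

  size≡ : size (oddExtremal m) ≡ ((suc (m + m) ∸ 1) ^ 2) / 2
  size≡ = trans (size-from-coDegree (oddExtremal m) (m * m + m * m) count) (sym half)
    where
    Σcoδ : sumFin (suc (m + m)) (coDegree (oddExtremal m)) ≡ (m + m) * 1
    Σcoδ = cong₂ _+_ coDegree-zero (trans (sumFin-cong (m + m) coDegree-suc) (sumFin-const (m + m) 1))
    count : m * m + m * m + (m * m + m * m) + sumFin (suc (m + m)) (coDegree (oddExtremal m)) + suc (m + m) ≡ suc (m + m) * suc (m + m)
    count rewrite Σcoδ = square m
      where
      square : ∀ m → m * m + m * m + (m * m + m * m) + (m + m) * 1 + suc (m + m) ≡ suc (m + m) * suc (m + m)
      square = solve-∀
    half : ((suc (m + m) ∸ 1) ^ 2) / 2 ≡ m * m + m * m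
    half = half-square-even m

pattern f0 = F.zero
pattern f1 = F.suc F.zero
pattern f2 = F.suc (F.suc F.zero)
pattern f3 = F.suc (F.suc (F.suc F.zero))
pattern s4 j = F.suc (F.suc (F.suc (F.suc j)))

p3Edge-blockEdge : ∀ a b → p3Edge (suc (suc (suc (suc a)))) (suc (suc (suc (suc b)))) ≡ blockEdge a b
p3Edge-blockEdge a b rewrite /2-suc-suc (suc (suc a)) | /2-suc-suc (suc (suc b)) | /2-suc-suc a | /2-suc-suc b = refl

module EvenExtremal (m : ℕ) where

  N = suc (suc (suc (suc (m + m))))

  nonAdj-0 : ∀ u → nonAdj (evenExtremal m) f0 u ≡ false
  nonAdj-0 f0     = refl
  nonAdj-0 f1     = refl
  nonAdj-0 f2     = refl
  nonAdj-0 f3     = refl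
  nonAdj-0 (s4 _) = refl

  nonAdj-1 : ∀ u → nonAdj (evenExtremal m) f1 u ≡ (u == f2)
  nonAdj-1 f0     = refl
  nonAdj-1 f1     = refl
  nonAdj-1 f2     = refl
  nonAdj-1 f3     = refl
  nonAdj-1 (s4 _) = refl

  nonAdj-2 : ∀ u → nonAdj (evenExtremal m) f2 u ≡ (u == f1) ∨ (u == f3)
  nonAdj-2 f0     = refl
  nonAdj-2 f1     = refl
  nonAdj-2 f2     = refl
  nonAdj-2 f3     = refl
  nonAdj-2 (s4 _) = refl

  nonAdj-3 : ∀ u → nonAdj (evenExtremal m) f3 u ≡ (u == f2)
  nonAdj-3 f0     = refl
  nonAdj-3 f1     = refl
  nonAdj-3 f2     = refl
  nonAdj-3 f3     = refl
  nonAdj-3 (s4 _) = refl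

  nonAdj-s4 : ∀ j u → nonAdj (evenExtremal m) (s4 j) u ≡ (u == s4 (pairPartner m j))
  nonAdj-s4 j f0     = refl
  nonAdj-s4 j f1     = refl
  nonAdj-s4 j f2     = refl
  nonAdj-s4 j f3     = refl
  nonAdj-s4 j (s4 k) = begin
    nonAdj (evenExtremal m) (s4 j) (s4 k)
      ≡⟨ nonAdj-complementOf p3Edge (s4 j) (s4 k) ⟩
    not (s4 k == s4 j) ∧ symm p3Edge (toℕ (s4 j)) (toℕ (s4 k))
      ≡⟨ cong₂ (λ x y → not x ∧ y) (==-s4 k j) (cong₂ _∨_ (p3Edge-blockEdge (toℕ j) (toℕ k)) (p3Edge-blockEdge (toℕ k) (toℕ j))) ⟩
    not (k == j) ∧ (blockEdge (toℕ j) (toℕ k) ∨ blockEdge (toℕ k) (toℕ j))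
      ≡⟨ blockEdge-pairPartner m j k ⟩
    (k == pairPartner m j)
      ≡⟨ sym (==-s4 k (pairPartner m j)) ⟩
    (s4 k == s4 (pairPartner m j))  ∎
    where
    open ≡-Reasoning
    ==-s4 : ∀ {n} (x y : Fin n) → (s4 x == s4 y) ≡ (x == y)
    ==-s4 x y = trans (==-suc _ _) (trans (==-suc _ _) (trans (==-suc _ _) (==-suc x y)))

  corner : Fin 4 → Fin N
  corner i = i ↑ˡ (m + m)

  coDegree-s4 : ∀ j → coDegree (evenExtremal m) (s4 j) ≡ 1
  coDegree-s4 j = trans (sumFin-cong N (λ u → cong ind (nonAdj-s4 j u))) (countFin-== N (s4 (pairPartner m j)))

  matchingOutside : MatchingOutside (evenExtremal m) corner
  matchingOutside = record { injective = ↑ˡ-injective (m + m) _ _ ; coDegree-one = one ; nonAdj-outside = outside }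
    where
    one : ∀ v → v ∉ corner → coDegree (evenExtremal m) v ≡ 1
    one f0     v∉ = ⊥-elim (v∉ f0 refl)
    one f1     v∉ = ⊥-elim (v∉ f1 refl)
    one f2     v∉ = ⊥-elim (v∉ f2 refl)
    one f3     v∉ = ⊥-elim (v∉ f3 refl)
    one (s4 j) _  = coDegree-s4 j
    s4∉corner : ∀ x → s4 x ∉ corner
    s4∉corner x f0 ()
    s4∉corner x f1 ()
    s4∉corner x f2 ()
    s4∉corner x f3 ()
    outside : ∀ v u → v ∉ corner → nonAdj (evenExtremal m) v u ≡ true → u ∉ corner
    outside f0     u v∉ _ = ⊥-elim (v∉ f0 refl)
    outside f1     u v∉ _ = ⊥-elim (v∉ f1 refl)
    outside f2     u v∉ _ = ⊥-elim (v∉ f2 refl)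
    outside f3     u v∉ _ = ⊥-elim (v∉ f3 refl)
    outside (s4 j) u _ vu = subst (_∉ corner) (sym (==⇒≡ (trans (sym (nonAdj-s4 j u)) vu))) (s4∉corner (pairPartner m j))

  coDegree-0 : coDegree (evenExtremal m) f0 ≡ 0
  coDegree-0 = countFin-none N _ nonAdj-0

  coDegree-1 : coDegree (evenExtremal m) f1 ≡ 1
  coDegree-1 = trans (sumFin-cong N (λ u → cong ind (nonAdj-1 u))) (countFin-== N f2)

  coDegree-2 : coDegree (evenExtremal m) f2 ≡ 2
  coDegree-2 = trans (sumFin-cong N (λ u → cong ind (nonAdj-2 u))) (cong (λ x → suc (suc x)) (countFin-none (m + m) _ (λ _ → refl)))

  coDegree-3 : coDegree (evenExtremal m) f3 ≡ 1
  coDegree-3 = trans (sumFin-cong N (λ u → cong ind (nonAdj-3 u))) (countFin-== N f2)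

  almostPeripheral : AlmostPeripheral (evenExtremal m)
  almostPeripheral = universal⇒almostPeripheral (evenExtremal m) (s≤s (s≤s z≤n)) f0 coDegree-0 nonUniversal
    where
    nonUniversal : ∀ v → v ≢ f0 → 1 ≤ coDegree (evenExtremal m) v
    nonUniversal f0     0≢0 = ⊥-elim (0≢0 refl)
    nonUniversal f1     _   = ≤-reflexive (sym coDegree-1)
    nonUniversal f2     _   = ≤-trans (s≤s z≤n) (≤-reflexive (sym coDegree-2))
    nonUniversal f3     _   = ≤-reflexive (sym coDegree-3)
    nonUniversal (s4 j) _   = ≤-reflexive (sym (coDegree-s4 j))

  size≡ : size (evenExtremal m) ≡ ((N ∸ 1) ^ 2) / 2
  size≡ = trans (size-from-coDegree (evenExtremal m) t count) (sym half)
    where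
    t = suc m * (m + m + 4)
    Σcoδ : sumFin N (coDegree (evenExtremal m)) ≡ 4 + (m + m) * 1
    Σcoδ = cong₂ _+_ coDegree-0 (cong₂ _+_ coDegree-1 (cong₂ _+_ coDegree-2 (cong₂ _+_ coDegree-3
             (trans (sumFin-cong (m + m) coDegree-s4) (sumFin-const (m + m) 1)))))
    count : t + t + sumFin N (coDegree (evenExtremal m)) + N ≡ N * N
    count rewrite Σcoδ = square m
      where
      square : ∀ m → suc m * (m + m + 4) + suc m * (m + m + 4) + (4 + (m + m) * 1) + (4 + (m + m))
                     ≡ (4 + (m + m)) * (4 + (m + m))
      square = solve-∀
    half : ((N ∸ 1) ^ 2) / 2 ≡ t
    half = half-square-odd m

-- Co-degrees at the extremal size

module _ {n : ℕ} (G : Graph n) (ap : AlmostPeripheral G) (2≤n : 2 ≤ n) where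

  private
    bound : Fin n → ℕ
    bound v = n ∸ 2 + ind (isUniversal G v)

    Σbound : sumFin n bound ≡ n * (n ∸ 2) + numUniversal G
    Σbound = trans (sumFin-+ n _ _) (cong (_+ numUniversal G) (sumFin-const n (n ∸ 2)))

    universal-unique : ∀ w → isUniversal G w ≡ true → ∀ v → v ≢ w → isUniversal G v ≡ false
    universal-unique w uw v v≢w with isUniversal G v in uv
    ... | false = refl
    ... | true = ⊥-elim (v≢w (countFin≤1⇒unique n _ (almostPeripheral⇒numUniversal≤1 G ap 2≤n) v w uv uw))

    coDegree-one : ∀ w → isUniversal G w ≡ true → ∀ v → v ≢ w → degree G v ≡ bound v → coDegree G v ≡ 1
    coDegree-one w uw v v≢w tight = coDegree-from-degree G 2≤n v 0
      (trans (+-identityʳ _) (trans tight (trans (cong (λ b → n ∸ 2 + ind b) (universal-unique w uw v v≢w)) (+-identityʳ _))))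

  Σdegree≡n[n∸2]+1⇒coDegrees : sumFin n (degree G) ≡ n * (n ∸ 2) + 1 →
    Σ (Fin n) λ w → coDegree G w ≡ 0 × (∀ v → v ≢ w → coDegree G v ≡ 1)
  Σdegree≡n[n∸2]+1⇒coDegrees Σδ = w , ≡ᵇ-true⇒≡ _ 0 uw , λ v v≢w → coDegree-one w uw v v≢w (tight v)
    where
    #universal≡1 : numUniversal G ≡ 1
    #universal≡1 = ≤-antisym (almostPeripheral⇒numUniversal≤1 G ap 2≤n)
      (+-cancelˡ-≤ (n * (n ∸ 2)) 1 _ (≤-trans (≤-reflexive (sym Σδ)) (sumFin-degree≤ G 2≤n)))
    tight : ∀ v → degree G v ≡ bound v
    tight = sumFin-tight n (degree G) bound (degree≤ G 2≤n)
      (≤-reflexive (trans Σbound (trans (cong (n * (n ∸ 2) +_) #universal≡1) (sym Σδ))))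
    w = proj₁ (countFin-witness n _ (≤-reflexive (sym #universal≡1)))
    uw = proj₂ (countFin-witness n _ (≤-reflexive (sym #universal≡1)))

  Σdegree≡n[n∸2]⇒coDegrees : 3 ≤ n → sumFin n (degree G) ≡ n * (n ∸ 2) →
    Σ (Fin n) λ w → Σ (Fin n) λ x → coDegree G w ≡ 0 × coDegree G x ≡ 2 × (∀ v → v ≢ w → v ≢ x → coDegree G v ≡ 1)
  Σdegree≡n[n∸2]⇒coDegrees 3≤n Σδ with numUniversal G in #u | almostPeripheral⇒numUniversal≤1 G ap 2≤n
  ... | zero | _ = ⊥-elim (coDegree≡1⇒¬almostPeripheral G 3≤n all-one ap)
    where
    tight : ∀ v → degree G v ≡ bound v
    tight = sumFin-tight n (degree G) bound (degree≤ G 2≤n)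
      (≤-reflexive (trans Σbound (trans (cong (n * (n ∸ 2) +_) #u) (trans (+-identityʳ _) (sym Σδ)))))
    all-one : ∀ v → coDegree G v ≡ 1
    all-one v = coDegree-from-degree G 2≤n v 0 (trans (+-identityʳ _) (trans (tight v)
      (trans (cong (λ b → n ∸ 2 + ind b) (countFin≡0⇒false n _ #u v)) (+-identityʳ _))))
  ... | suc zero | _ = w , x , ≡ᵇ-true⇒≡ _ 0 uw , coDegree-x , others
    where
    w : Fin n
    w = proj₁ (countFin-witness n _ (≤-reflexive (sym #u)))
    uw : isUniversal G w ≡ true
    uw = proj₂ (countFin-witness n _ (≤-reflexive (sym #u)))
    slack : Σ (Fin n) λ x → suc (degree G x) ≡ bound x × (∀ v → v ≢ x → degree G v ≡ bound v)
    slack = sumFin-slack-one n (degree G) bound (degree≤ G 2≤n)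
      (trans Σbound (trans (cong (n * (n ∸ 2) +_) #u) (trans (+-comm _ 1) (cong suc (sym Σδ)))))
    x : Fin n
    x = proj₁ slack
    x≢w : x ≢ w
    x≢w x≡w = impossible 2≤n (begin
      suc (degree G w)           ≡⟨ 1+d≡d+0+1 (degree G w) ⟩
      degree G w + 0 + 1         ≡⟨ cong (λ c → degree G w + c + 1) (sym (≡ᵇ-true⇒≡ _ 0 uw)) ⟩
      degree G w + coDegree G w + 1 ≡⟨ degree+coDegree G w ⟩
      n                          ∎) (begin
      suc (degree G w)           ≡⟨ subst (λ v → suc (degree G v) ≡ bound v) x≡w (proj₁ (proj₂ slack)) ⟩
      n ∸ 2 + ind (isUniversal G w) ≡⟨ cong (λ b → n ∸ 2 + ind b) uw ⟩
      n ∸ 2 + 1                  ∎)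
      where
      open ≡-Reasoning
      1+d≡d+0+1 : ∀ d → suc d ≡ d + 0 + 1
      1+d≡d+0+1 d = trans (+-comm 1 d) (cong (_+ 1) (sym (+-identityʳ d)))
      impossible : ∀ {n d} → 2 ≤ n → suc d ≡ n → suc d ≡ n ∸ 2 + 1 → ⊥
      impossible {suc zero}    (s≤s ()) _    _
      impossible {suc (suc k)} _        refl e = 1+n≢n (trans e (+-comm k 1))
    coDegree-x : coDegree G x ≡ 2
    coDegree-x = coDegree-from-degree G 2≤n x 1 (trans (+-comm _ 1) (trans (proj₁ (proj₂ slack))
      (trans (cong (λ b → n ∸ 2 + ind b) (universal-unique w uw x x≢w)) (+-identityʳ _))))
    others : ∀ v → v ≢ w → v ≢ x → coDegree G v ≡ 1
    others v v≢w v≢x = coDegree-one w uw v v≢w (proj₂ (proj₂ slack) v v≢x)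
  ... | suc (suc _) | s≤s ()

-- Uniqueness

oddExtremal-size⇒Σdegree : ∀ m′ (G : Graph (suc (suc m′ + suc m′))) → size G ≡ ((suc (suc m′ + suc m′) ∸ 1) ^ 2) / 2 →
  sumFin (suc (suc m′ + suc m′)) (degree G) ≡ suc (suc m′ + suc m′) * (m′ + suc m′) + 1
oddExtremal-size⇒Σdegree m′ G size≡ =
  trans (sym (handshake G)) (trans (cong (λ s → s + s) (trans size≡ (half-square-even (suc m′)))) (identity m′))
  where
  identity : ∀ m′ → let m = suc m′ in m * m + m * m + (m * m + m * m) ≡ suc (m + m) * (m′ + suc m′) + 1
  identity = solve-∀

module OddCase (m : ℕ) {G : Graph (suc (m + m))} {w : Fin (suc (m + m))}
  (coDegree-w : coDegree G w ≡ 0) (coDegree-one : ∀ v → v ≢ w → coDegree G v ≡ 1) where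

  matching : MatchingOutside G (λ (_ : Fin 1) → w)
  matching = record
    { injective      = λ { {F.zero} {F.zero} _ → refl }
    ; coDegree-one   = λ v v∉ → coDegree-one v (v∉ F.zero)
    ; nonAdj-outside = outside
    }
    where
    outside : ∀ v u → v ∉ (λ (_ : Fin 1) → w) → nonAdj G v u ≡ true → u ∉ (λ (_ : Fin 1) → w)
    outside v u _ vu F.zero refl with trans (sym vu) (coDegree≡0⇒¬nonAdj G w coDegree-w v)
    ... | ()

  isomorphic : G ≅ oddExtremal m
  isomorphic = ≅-fromMatchingOutside matching (OddExtremal.matchingOutside m) (λ _ _ → nonAdj-irrefl G w)

oddExtremal-unique : ∀ m → 1 ≤ m → (G : Graph (suc (m + m))) → AlmostPeripheral G →
  size G ≡ ((suc (m + m) ∸ 1) ^ 2) / 2 → G ≅ oddExtremal m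
oddExtremal-unique m@(suc m′) _ G ap size≡ = OddCase.isomorphic m {G} (proj₁ (proj₂ profile)) (proj₂ (proj₂ profile))
  where
  profile : Σ (Fin (suc (m + m))) λ w → coDegree G w ≡ 0 × (∀ v → v ≢ w → coDegree G v ≡ 1)
  profile = Σdegree≡n[n∸2]+1⇒coDegrees G ap (s≤s (s≤s z≤n)) (oddExtremal-size⇒Σdegree m′ G size≡)

module EvenCase (m : ℕ) {G : Graph (suc (suc (suc (suc (m + m)))))} {w x : Fin (suc (suc (suc (suc (m + m)))))}
  (coDegree-w : coDegree G w ≡ 0) (coDegree-x : coDegree G x ≡ 2) (coDegree-one : ∀ v → v ≢ w → v ≢ x → coDegree G v ≡ 1) where

  n = suc (suc (suc (suc (m + m))))
  x-nonNeighbours : Σ (Fin n) λ y → Σ (Fin n) λ z → y ≢ z × nonAdj G x y ≡ true × nonAdj G x z ≡ true × (∀ u → nonAdj G x u ≡ true → u ≡ y ⊎ u ≡ z)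
  x-nonNeighbours = countFin≡2⇒pair n (nonAdj G x) coDegree-x
  y z : Fin n
  y = proj₁ x-nonNeighbours
  z = proj₁ (proj₂ x-nonNeighbours)
  y≢z : y ≢ z
  y≢z = proj₁ (proj₂ (proj₂ x-nonNeighbours))
  xy : nonAdj G x y ≡ true
  xy = proj₁ (proj₂ (proj₂ (proj₂ x-nonNeighbours)))
  xz : nonAdj G x z ≡ true
  xz = proj₁ (proj₂ (proj₂ (proj₂ (proj₂ x-nonNeighbours))))
  x-only : ∀ u → nonAdj G x u ≡ true → u ≡ y ⊎ u ≡ z
  x-only = proj₂ (proj₂ (proj₂ (proj₂ (proj₂ x-nonNeighbours))))
  ¬nonAdj-w : ∀ u → nonAdj G w u ≡ false
  ¬nonAdj-w = countFin≡0⇒false n _ coDegree-w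
  ¬nonAdj-·w : ∀ u → nonAdj G u w ≡ false
  ¬nonAdj-·w = coDegree≡0⇒¬nonAdj G w coDegree-w
  ≢-by : ∀ {u v} → nonAdj G x u ≡ true → nonAdj G x v ≡ false → u ≢ v
  ≢-by xu ¬xv refl with trans (sym xu) ¬xv
  ... | ()
  y≢w : y ≢ w
  y≢w = ≢-by xy (¬nonAdj-·w x)
  z≢w : z ≢ w
  z≢w = ≢-by xz (¬nonAdj-·w x)
  x≢w : x ≢ w
  x≢w refl with trans (sym xy) (¬nonAdj-w y)
  ... | ()
  y≢x : y ≢ x
  y≢x = nonAdj⇒≢ G x y xy
  z≢x : z ≢ x
  z≢x = nonAdj⇒≢ G x z xz
  only-x : ∀ v → v ≢ w → v ≢ x → nonAdj G v x ≡ true → ∀ u → nonAdj G v u ≡ true → u ≡ x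
  only-x v v≢w v≢x vx u vu = countFin≤1⇒unique n (nonAdj G v) (≤-reflexive (coDegree-one v v≢w v≢x)) u x vu vx
  yx : nonAdj G y x ≡ true
  yx = trans (nonAdj-sym G y x) xy
  zx : nonAdj G z x ≡ true
  zx = trans (nonAdj-sym G z x) xz
  a : Fin 4 → Fin n
  a f0 = w
  a f1 = y
  a f2 = x
  a f3 = z
  matching : MatchingOutside G a
  matching = record { injective = injective ; coDegree-one = λ v v∉ → coDegree-one v (v∉ f0) (v∉ f2) ; nonAdj-outside = outside }
    where
    injective : ∀ {i j} → a i ≡ a j → i ≡ j
    injective {f0} {f0} _ = refl
    injective {f0} {f1} e = ⊥-elim (y≢w (sym e))
    injective {f0} {f2} e = ⊥-elim (x≢w (sym e))
    injective {f0} {f3} e = ⊥-elim (z≢w (sym e))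
    injective {f1} {f0} e = ⊥-elim (y≢w e)
    injective {f1} {f1} _ = refl
    injective {f1} {f2} e = ⊥-elim (y≢x e)
    injective {f1} {f3} e = ⊥-elim (y≢z e)
    injective {f2} {f0} e = ⊥-elim (x≢w e)
    injective {f2} {f1} e = ⊥-elim (y≢x (sym e))
    injective {f2} {f2} _ = refl
    injective {f2} {f3} e = ⊥-elim (z≢x (sym e))
    injective {f3} {f0} e = ⊥-elim (z≢w e)
    injective {f3} {f1} e = ⊥-elim (y≢z (sym e))
    injective {f3} {f2} e = ⊥-elim (z≢x e)
    injective {f3} {f3} _ = refl
    outside : ∀ v u → v ∉ a → nonAdj G v u ≡ true → u ∉ a
    outside v u v∉ vu f0 refl with trans (sym vu) (¬nonAdj-·w v)
    ... | ()
    outside v u v∉ vu f1 refl = v∉ f2 (only-x y y≢w y≢x yx v (trans (nonAdj-sym G y v) vu))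
    outside v u v∉ vu f2 refl with x-only v (trans (nonAdj-sym G x v) vu)
    ... | inj₁ v≡y = v∉ f1 v≡y
    ... | inj₂ v≡z = v∉ f3 v≡z
    outside v u v∉ vu f3 refl = v∉ f2 (only-x z z≢w z≢x zx v (trans (nonAdj-sym G z v) vu))
  same : ∀ i j → nonAdj G (a i) (a j) ≡ nonAdj (evenExtremal m) (EvenExtremal.corner m i) (EvenExtremal.corner m j)
  same f0 f0 = ¬nonAdj-w w
  same f0 f1 = ¬nonAdj-w y
  same f0 f2 = ¬nonAdj-w x
  same f0 f3 = ¬nonAdj-w z
  same f1 f0 = ¬nonAdj-·w y
  same f1 f1 = nonAdj-irrefl G y
  same f1 f2 = yx
  same f1 f3 = ¬true⇒false (only-x y y≢w y≢x yx z) z≢x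
  same f2 f0 = ¬nonAdj-·w x
  same f2 f1 = xy
  same f2 f2 = nonAdj-irrefl G x
  same f2 f3 = xz
  same f3 f0 = ¬nonAdj-·w z
  same f3 f1 = ¬true⇒false (only-x z z≢w z≢x zx y) y≢x
  same f3 f2 = zx
  same f3 f3 = nonAdj-irrefl G z


  isomorphic : G ≅ evenExtremal m
  isomorphic = ≅-fromMatchingOutside matching (EvenExtremal.matchingOutside m) same

evenExtremal-size⇒Σdegree : ∀ m (G : Graph (suc (suc (suc (suc (m + m)))))) →
  size G ≡ ((suc (suc (suc (suc (m + m)))) ∸ 1) ^ 2) / 2 → sumFin (4 + (m + m)) (degree G) ≡ (4 + (m + m)) * (2 + (m + m))
evenExtremal-size⇒Σdegree m G size≡ =
  trans (sym (handshake G)) (trans (cong (λ s → s + s) (trans size≡ (half-square-odd m))) (identity m))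
  where
  identity : ∀ m → suc m * (m + m + 4) + suc m * (m + m + 4) ≡ (4 + (m + m)) * (2 + (m + m))
  identity = solve-∀

evenExtremal-unique : ∀ m → (G : Graph (suc (suc (suc (suc (m + m)))))) → AlmostPeripheral G →
  size G ≡ ((suc (suc (suc (suc (m + m)))) ∸ 1) ^ 2) / 2 → G ≅ evenExtremal m
-- projections, not `with`: abstracting over the profile makes Agda unfold its proof
evenExtremal-unique m G ap size≡ =
  EvenCase.isomorphic m {G} (proj₁ (proj₂ (proj₂ profile))) (proj₁ (proj₂ (proj₂ (proj₂ profile)))) (proj₂ (proj₂ (proj₂ (proj₂ profile))))
  where
  n = suc (suc (suc (suc (m + m))))
  profile : Σ (Fin n) λ w → Σ (Fin n) λ x → coDegree G w ≡ 0 × coDegree G x ≡ 2 × (∀ v → v ≢ w → v ≢ x → coDegree G v ≡ 1)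
  profile = Σdegree≡n[n∸2]⇒coDegrees G ap (s≤s (s≤s z≤n)) (s≤s (s≤s (s≤s z≤n))) (evenExtremal-size⇒Σdegree m G size≡)

theorem9 :
    (∀ (n : ℕ) → 3 ≤ n → (G : Graph n) → AlmostPeripheral G →
       size G ≤ ((n ∸ 1) ^ 2) / 2)
    × (∀ (m : ℕ) → 1 ≤ m →
         AlmostPeripheral (oddExtremal m)
         × size (oddExtremal m) ≡ ((suc (m + m) ∸ 1) ^ 2) / 2
         × ((G : Graph (suc (m + m))) → AlmostPeripheral G →
              size G ≡ ((suc (m + m) ∸ 1) ^ 2) / 2 → G ≅ oddExtremal m))
    × (∀ (m : ℕ) →
         AlmostPeripheral (evenExtremal m)
         × size (evenExtremal m) ≡ ((suc (suc (suc (suc (m + m)))) ∸ 1) ^ 2) / 2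
         × ((G : Graph (suc (suc (suc (suc (m + m)))))) → AlmostPeripheral G →
              size G ≡ ((suc (suc (suc (suc (m + m)))) ∸ 1) ^ 2) / 2 → G ≅ evenExtremal m))
theorem9 =
    (λ n 3≤n → almostPeripheral⇒size≤ n (≤-trans (s≤s (s≤s z≤n)) 3≤n))
  , (λ m 1≤m → OddExtremal.almostPeripheral m 1≤m , OddExtremal.size≡ m , oddExtremal-unique m 1≤m)
  , (λ m → EvenExtremal.almostPeripheral m , EvenExtremal.size≡ m , evenExtremal-unique m)
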